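{- Let $A,B\subseteq\mathbb{Z}$ be finite nonempty sets with $\min A=\min B=0$, $M=\max A$, $N=\max B$ and $M\geq N$, and write $|A+B|=|A|+|B|-1+r$. Suppose $h_A\leq |B|-2$ and $r\leq |B|-2-\delta(A,B)$. Let $e$ be the greatest left stable hole in $B$ ($e=-1$ if there are none) and $c$ the smallest right stable hole in $B$ ($c=N+1$ if there are none). Then $$J:=[e+1,M+c-1]\subseteq A+B,$$ and $$|J|=M-1+(c-e)\geq |A|+|B|-1+h_{A,[e+1,c+M-N-1]}+h_{B,[e+1,c-1]}\geq |A|+|B|-1.$$
   Context: For integers $a\le b$, $[a,b]=\{x\in\mathbb{Z}: a\le x\le b\}$ (empty if $a>b$). For $X\subseteq\mathbb{Z}$ and an interval $[a,b]$, $h_{X,[a,b]}=|[a,b]\setminus X|$, and $h_X=h_{X,[\min X,\max X]}$. $A+B=\{a+b:a\in A,b\in B\}$. $\delta(A,B)=1$ if $x+A\subseteq B$ for some $x\in\mathbb{Z}$, and $0$ otherwise. An element $x\in[0,N-1]\setminus B$ with $x\notin A+B$ is a left stable hole in $B$; an element $x\in[1,N]\setminus B$ with $x+M\notin A+B$ is a right stable hole in $B$. -}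

module Defs where

open import Data.Nat using (ℕ; suc)
open import Data.Integer using (ℤ; +_; -[1+_]; _+_; _-_; _≤_)
open import Data.Integer.Properties using () renaming (_≟_ to _≟ℤ_)
open import Data.List using (List; []; _∷_; map; upTo; length; filter; deduplicate; cartesianProductWith)
open import Data.List.Membership.Propositional using (_∈_; _∉_)
open import Data.List.Membership.DecPropositional _≟ℤ_ using (_∈?_)
open import Data.List.Relation.Unary.Unique.Propositional using (Unique)
open import Data.List.Relation.Unary.All using (All)
open import Data.Product using (_×_; ∃)
open import Data.Sum using (_⊎_)
open import Relation.Nullary using (¬_; ¬?)
open import Relation.Binary.PropositionalEquality using (_≡_)

-- A finite subset of ℤ is represented by a duplicate-free list of its elements.

range : ℤ → ℤ → List ℤ
range a b with b - a
... | + n = map (λ k → a + + k) (upTo (suc n))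
... | -[1+ _ ] = []

card : List ℤ → ℤ
card xs = + length xs

sumset : List ℤ → List ℤ → List ℤ
sumset A B = deduplicate _≟ℤ_ (cartesianProductWith _+_ A B)

hIn : List ℤ → ℤ → ℤ → ℤ
hIn X a b = + length (filter (λ x → ¬? (x ∈? X)) (range a b))

IsMin : List ℤ → ℤ → Set
IsMin X m = m ∈ X × All (λ x → m ≤ x) X

IsMax : List ℤ → ℤ → Set
IsMax X m = m ∈ X × All (λ x → x ≤ m) X


ShiftContained : List ℤ → List ℤ → Set
ShiftContained A B = ∃ λ (x : ℤ) → ∀ a → a ∈ A → (x + a) ∈ B

IsDelta : List ℤ → List ℤ → ℤ → Set
IsDelta A B d = (ShiftContained A B × d ≡ + 1) ⊎ (¬ ShiftContained A B × d ≡ + 0)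

LeftStableHole : List ℤ → List ℤ → ℤ → ℤ → Set
LeftStableHole A B N x = + 0 ≤ x × x ≤ N - + 1 × x ∉ B × x ∉ sumset A B

RightStableHole : List ℤ → List ℤ → ℤ → ℤ → ℤ → Set
RightStableHole A B M N x = + 1 ≤ x × x ≤ N × x ∉ B × (x + M) ∉ sumset A B

IsGreatestLeftStableHole : List ℤ → List ℤ → ℤ → ℤ → Set
IsGreatestLeftStableHole A B N e =
  (LeftStableHole A B N e × (∀ x → LeftStableHole A B N x → x ≤ e))
  ⊎ ((∀ x → ¬ LeftStableHole A B N x) × e ≡ -[1+ 0 ])

IsSmallestRightStableHole : List ℤ → List ℤ → ℤ → ℤ → ℤ → Set
IsSmallestRightStableHole A B M N c =
  (RightStableHole A B M N c × (∀ x → RightStableHole A B M N x → c ≤ x))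
  ⊎ ((∀ x → ¬ RightStableHole A B M N x) × c ≡ N + + 1)

-- Write S = A + B and h_A = h_{A,[0,M]}. If x ∉ S, no k ∈ A has x − k ∈ B, so the M + 1 reflections
-- x − [0, M] meet B at most h_A times. As h_A ≤ |B| − 2, this puts [N, M] inside S and excludes a
-- z ∈ [0, N] with z, z + M ∉ S. So a point of J missing from S would be a left stable hole above e
-- (below N) or give the right stable hole x − M below c (above M). Once e < c, splitting A and B at
-- e + 1 and c (shifted by M − N for A) and reflecting the outer parts through e and c + M gives the bound.
-- If c ≤ e, take a right stable hole y below a left stable hole x as close as possible; then every
-- point of (y, x) ∖ B lies in S together with its translate by M. Counting S through the pairs
-- {i, i + M} gives |S| ≥ M + |B| + |(y, x) ∖ B|, and reflecting B through x and y + M gives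
-- |B| + |B ∩ (y, x)| ≤ h_A + |[y + M − N, x] ∖ A|; these contradict r ≤ |B| − 2 − δ(A, B).

module Submission where

open import Defs
open import Data.Nat as ℕ using (ℕ; zero; suc; z≤n; s≤s)
import Data.Nat.Properties as ℕP
open import Data.Nat.Induction using (<-rec)
open import Data.Nat.Tactic.RingSolver using () renaming (solve-∀ to ℕ-solve-∀)
open import Data.Integer as ℤ using (ℤ; +_; -[1+_]; _+_; _-_; -_; _≤_; _≥_; _<_; +≤+)
import Data.Integer.Properties as ℤP
open import Data.Integer.Properties using () renaming (_≟_ to _≟ℤ_)
open import Data.Integer.Tactic.RingSolver using (solve-∀)
open import Data.List using (List; []; _∷_; length; map; upTo; filter; applyUpTo; cartesianProductWith)
import Data.List.Properties as ListP
open import Data.List.Membership.Propositional using (_∈_; _∉_; find; lose)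
open import Data.List.Membership.DecPropositional _≟ℤ_ using (_∈?_)
open import Data.List.Membership.Propositional.Properties
  using (∈-deduplicate⁺; ∈-deduplicate⁻; ∈-cartesianProductWith⁺; ∈-cartesianProductWith⁻)
open import Data.List.Relation.Unary.Unique.Propositional using (Unique)
open import Data.List.Relation.Unary.Unique.DecPropositional.Properties _≟ℤ_ using (deduplicate-!)
open import Data.List.Relation.Unary.AllPairs using (_∷_)
import Data.List.Relation.Unary.All as All
open import Data.List.Relation.Unary.All.Properties using (All¬⇒¬Any; ¬All⇒Any¬)
open import Data.List.Relation.Unary.Any using (here; there; any?)
open import Data.Product using (Σ; ∃; ∃₂; _×_; _,_; proj₁; proj₂)
open import Data.Sum using (_⊎_; inj₁; inj₂)
open import Data.Empty using (⊥; ⊥-elim)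
open import Data.Unit using (⊤; tt)
open import Relation.Nullary using (¬_; Dec; yes; no; ¬?; _×-dec_; _⊎-dec_)
open import Relation.Nullary.Decidable using (decidable-stable)
open import Relation.Binary.PropositionalEquality
  using (_≡_; refl; sym; trans; cong; cong₂; subst; subst₂; module ≡-Reasoning)

≤⇒∃ : ∀ {a b} → a ≤ b → ∃ λ k → b ≡ a + + k
≤⇒∃ {a} {b} a≤b = ℤ.∣ b - a ∣ , (begin
  b                 ≡⟨ b≡a+[b-a] a b ⟩
  a + (b - a)       ≡⟨ cong (_+_ a) (ℤP.0≤i⇒+∣i∣≡i (ℤP.i≤j⇒0≤j-i a≤b)) ⟨
  a + + ℤ.∣ b - a ∣ ∎)
  where
  open ≡-Reasoning
  b≡a+[b-a] : ∀ a b → b ≡ a + (b - a)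
  b≡a+[b-a] = solve-∀

[i+j]-j≡i : ∀ i j → i + j - j ≡ i
[i+j]-j≡i = solve-∀

[i+j]-i≡j : ∀ i j → i + j - i ≡ j
[i+j]-i≡j = solve-∀

[i-j]+j≡i : ∀ i j → i - j + j ≡ i
[i-j]+j≡i = solve-∀

-- Linear inequalities are proved by writing j − i as a sum of differences known to be nonnegative;
-- the ring solver checks the identity.
≤-via : ∀ {a b c d i j} → a ≤ b → c ≤ d → j - i ≡ (b - a) + (d - c) → i ≤ j
≤-via a≤b c≤d eq = ℤP.0≤i-j⇒j≤i (subst (+ 0 ≤_) (sym eq) (ℤP.+-mono-≤ (ℤP.i≤j⇒0≤j-i a≤b) (ℤP.i≤j⇒0≤j-i c≤d)))

≤-via₁ : ∀ {a b i j} → a ≤ b → j - i ≡ b - a → i ≤ j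
≤-via₁ a≤b eq = ℤP.0≤i-j⇒j≤i (subst (+ 0 ≤_) (sym eq) (ℤP.i≤j⇒0≤j-i a≤b))

+1≤⇒< : ∀ {i j} → i + + 1 ≤ j → i < j
+1≤⇒< {i} i+1≤j = ℤP.suc[i]≤j⇒i<j (subst (_≤ _) (ℤP.+-comm i (+ 1)) i+1≤j)

<⇒+1≤ : ∀ {i j} → i < j → i + + 1 ≤ j
<⇒+1≤ {i} i<j = subst (_≤ _) (ℤP.+-comm (+ 1) i) (ℤP.i<j⇒suc[i]≤j i<j)

i+1≰i : ∀ {i} → ¬ (i + + 1 ≤ i)
i+1≰i i+1≤i = ℤP.<-irrefl refl (+1≤⇒< i+1≤i)

offset-cancel-≤ : ∀ a {k l} → a + + k ≤ a + + l → k ℕ.≤ l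
offset-cancel-≤ a {k} {l} p = ℤP.drop‿+≤+
  (subst₂ _≤_ ([i+j]-i≡j a (+ k)) ([i+j]-i≡j a (+ l)) (ℤP.+-monoˡ-≤ (- a) p))

offset-injective : ∀ a {k l} → a + + k ≡ a + + l → k ≡ l
offset-injective a {k} {l} eq = ℤP.+-injective (begin
  + k             ≡⟨ [i+j]-i≡j a (+ k) ⟨
  a + + k - a     ≡⟨ cong (_- a) eq ⟩
  a + + l - a     ≡⟨ [i+j]-i≡j a (+ l) ⟩
  + l             ∎)
  where open ≡-Reasoning

-- Sums of indicators over integer intervals

𝟙 : {P : Set} → Dec P → ℕ
𝟙 (yes _) = 1
𝟙 (no _)  = 0

𝟙-yes : {P : Set} (P? : Dec P) → P → 𝟙 P? ≡ 1
𝟙-yes (yes _) _ = refl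
𝟙-yes (no ¬p) p = ⊥-elim (¬p p)

𝟙-no : {P : Set} (P? : Dec P) → ¬ P → 𝟙 P? ≡ 0
𝟙-no (yes p) ¬p = ⊥-elim (¬p p)
𝟙-no (no _)  _  = refl

𝟙≤1 : {P : Set} (P? : Dec P) → 𝟙 P? ℕ.≤ 1
𝟙≤1 (yes _) = ℕP.≤-refl
𝟙≤1 (no _)  = z≤n

𝟙-mono : {P Q : Set} (P? : Dec P) (Q? : Dec Q) → (P → Q) → 𝟙 P? ℕ.≤ 𝟙 Q?
𝟙-mono (yes p) Q? P⇒Q = ℕP.≤-reflexive (sym (𝟙-yes Q? (P⇒Q p)))
𝟙-mono (no _)  Q? P⇒Q = z≤n

𝟙-cong : {P Q : Set} (P? : Dec P) (Q? : Dec Q) → (P → Q) → (Q → P) → 𝟙 P? ≡ 𝟙 Q?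
𝟙-cong P? Q? P⇒Q Q⇒P = ℕP.≤-antisym (𝟙-mono P? Q? P⇒Q) (𝟙-mono Q? P? Q⇒P)

𝟙+𝟙¬≡1 : {P : Set} (P? : Dec P) → 𝟙 P? ℕ.+ 𝟙 (¬? P?) ≡ 1
𝟙+𝟙¬≡1 (yes _) = refl
𝟙+𝟙¬≡1 (no _)  = refl

𝟙+𝟙≤1 : {P Q : Set} (P? : Dec P) (Q? : Dec Q) → (P → Q → ⊥) → 𝟙 P? ℕ.+ 𝟙 Q? ℕ.≤ 1
𝟙+𝟙≤1 (yes p) Q? disj = ℕP.≤-reflexive (cong suc (𝟙-no Q? (disj p)))
𝟙+𝟙≤1 (no _)  Q? disj = 𝟙≤1 Q?

𝟙+𝟙≤𝟙+𝟙 : {P Q R T : Set} (P? : Dec P) (Q? : Dec Q) (R? : Dec R) (T? : Dec T) →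
  (P → R) → (Q → R) → (P → Q → T) → 𝟙 P? ℕ.+ 𝟙 Q? ℕ.≤ 𝟙 R? ℕ.+ 𝟙 T?
𝟙+𝟙≤𝟙+𝟙 (yes p) (yes q) R? T? P⇒R Q⇒R P⇒Q⇒T =
  ℕP.+-mono-≤ (𝟙-mono (yes p) R? P⇒R) (𝟙-mono (yes q) T? (P⇒Q⇒T p))
𝟙+𝟙≤𝟙+𝟙 (yes p) (no _)  R? T? P⇒R Q⇒R P⇒Q⇒T =
  ℕP.≤-trans (𝟙-mono (yes p) R? P⇒R) (ℕP.m≤m+n (𝟙 R?) (𝟙 T?))
𝟙+𝟙≤𝟙+𝟙 (no _)  Q?      R? T? P⇒R Q⇒R P⇒Q⇒T =
  ℕP.≤-trans (𝟙-mono Q? R? Q⇒R) (ℕP.m≤m+n (𝟙 R?) (𝟙 T?))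

𝟙+𝟙≤𝟙 : {P Q R : Set} (P? : Dec P) (Q? : Dec Q) (R? : Dec R) →
  (P → R) → (Q → R) → (P → Q → ⊥) → 𝟙 P? ℕ.+ 𝟙 Q? ℕ.≤ 𝟙 R?
𝟙+𝟙≤𝟙 (yes p) (yes q) R? _   _   disj = ⊥-elim (disj p q)
𝟙+𝟙≤𝟙 (yes p) (no _)  R? P⇒R _   _    = 𝟙-mono (yes p) R? P⇒R
𝟙+𝟙≤𝟙 (no _)  Q?      R? _   Q⇒R _    = 𝟙-mono Q? R? Q⇒R

𝟙-×-dec : {P Q : Set} (P? : Dec P) (Q? : Dec Q) → P → 𝟙 (P? ×-dec Q?) ≡ 𝟙 Q?
𝟙-×-dec (yes _) (yes _) _ = refl
𝟙-×-dec (yes _) (no _)  _ = refl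
𝟙-×-dec (no ¬p) Q?      p = ⊥-elim (¬p p)

∑ : (ℤ → ℕ) → ℤ → ℕ → ℕ
∑ f a zero    = 0
∑ f a (suc n) = ∑ f a n ℕ.+ f (a + + n)

InRange : ℤ → ℕ → ℤ → Set
InRange a n z = ∃ λ k → k ℕ.< n × z ≡ a + + k

inRange : ∀ {a z} L → a ≤ z → z ≤ a + + L → InRange a (suc L) z
inRange {a} L a≤z z≤a+L with ≤⇒∃ a≤z
... | k , refl = k , s≤s (offset-cancel-≤ a z≤a+L) , refl

module _ (f : ℤ → ℕ) where

  ∑-++ : ∀ a n m → ∑ f a (n ℕ.+ m) ≡ ∑ f a n ℕ.+ ∑ f (a + + n) m
  ∑-++ a n zero    rewrite ℕP.+-identityʳ n = sym (ℕP.+-identityʳ _)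
  ∑-++ a n (suc m) rewrite ℕP.+-suc n m | ∑-++ a n m | ℤP.+-assoc a (+ n) (+ m) =
    ℕP.+-assoc (∑ f a n) _ _

  ∑-++′ : ∀ a b n m → b ≡ a + + n → ∑ f a (n ℕ.+ m) ≡ ∑ f a n ℕ.+ ∑ f b m
  ∑-++′ a _ n m refl = ∑-++ a n m

  ∑-++₃ : ∀ j k q → ∑ f (+ 0) (j ℕ.+ k ℕ.+ q) ≡ ∑ f (+ 0) j ℕ.+ ∑ f (+ j) k ℕ.+ ∑ f (+ (j ℕ.+ k)) q
  ∑-++₃ j k q = trans (∑-++ (+ 0) (j ℕ.+ k) q) (cong (ℕ._+ ∑ f (+ (j ℕ.+ k)) q) (∑-++ (+ 0) j k))

  ∑-head : ∀ a n → ∑ f a (suc n) ≡ f a ℕ.+ ∑ f (a + + 1) n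
  ∑-head a n = trans (∑-++ a 1 n) (cong (λ z → f z ℕ.+ ∑ f (a + + 1) n) (ℤP.+-identityʳ a))

  ∑-≡0 : ∀ a n → (∀ k → k ℕ.< n → f (a + + k) ≡ 0) → ∑ f a n ≡ 0
  ∑-≡0 a zero    _    = refl
  ∑-≡0 a (suc n) f≡0 rewrite ∑-≡0 a n (λ k k<n → f≡0 k (ℕP.m<n⇒m<1+n k<n)) = f≡0 n ℕP.≤-refl

  ∑-≡len : ∀ a n → (∀ k → k ℕ.< n → f (a + + k) ≡ 1) → ∑ f a n ≡ n
  ∑-≡len a zero    _    = refl
  ∑-≡len a (suc n) f≡1 rewrite ∑-≡len a n (λ k k<n → f≡1 k (ℕP.m<n⇒m<1+n k<n)) | f≡1 n ℕP.≤-refl =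
    ℕP.+-comm n 1

  ∑-≤len : ∀ a n → (∀ k → k ℕ.< n → f (a + + k) ℕ.≤ 1) → ∑ f a n ℕ.≤ n
  ∑-≤len a zero    _    = z≤n
  ∑-≤len a (suc n) f≤1 = subst (∑ f a (suc n) ℕ.≤_) (ℕP.+-comm n 1)
    (ℕP.+-mono-≤ (∑-≤len a n (λ k k<n → f≤1 k (ℕP.m<n⇒m<1+n k<n))) (f≤1 n ℕP.≤-refl))

  ∑-reflect : ∀ x a b n → b + + n ≡ x - a + + 1 → ∑ (λ i → f (x - i)) a n ≡ ∑ f b n
  ∑-reflect x a b zero    _ = refl
  ∑-reflect x a b (suc n) b+n+1≡x-a+1 = begin
    ∑ (λ i → f (x - i)) a n ℕ.+ f (x - (a + + n)) ≡⟨ cong₂ ℕ._+_ (∑-reflect x a (b + + 1) n b+1+n≡) (cong f x-[a+n]≡b) ⟩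
    ∑ f (b + + 1) n ℕ.+ f b                        ≡⟨ ℕP.+-comm _ (f b) ⟩
    f b ℕ.+ ∑ f (b + + 1) n                        ≡⟨ ∑-head b n ⟨
    ∑ f b (suc n)                                  ∎
    where
    open ≡-Reasoning
    b+1+n≡ : b + + 1 + + n ≡ x - a + + 1
    b+1+n≡ = trans (ℤP.+-assoc b (+ 1) (+ n)) b+n+1≡x-a+1
    x-[a+n]≡b : x - (a + + n) ≡ b
    x-[a+n]≡b = begin
      x - (a + + n)               ≡⟨ regroup x a (+ n) ⟩
      (x - a + + 1) - + suc n     ≡⟨ cong (_- + suc n) b+n+1≡x-a+1 ⟨
      b + + suc n - + suc n       ≡⟨ [i+j]-j≡i b (+ suc n) ⟩
      b                           ∎
      where
      regroup : ∀ x a t → x - (a + t) ≡ (x - a + + 1) - (+ 1 + t)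
      regroup = solve-∀

  ∑-cong : ∀ {g : ℤ → ℕ} a b n → (∀ k → k ℕ.< n → f (a + + k) ≡ g (b + + k)) → ∑ f a n ≡ ∑ g b n
  ∑-cong a b zero    _   = refl
  ∑-cong a b (suc n) f≡g = cong₂ ℕ._+_ (∑-cong a b n (λ k k<n → f≡g k (ℕP.m<n⇒m<1+n k<n))) (f≡g n ℕP.≤-refl)

  ∑-mono : ∀ {g : ℤ → ℕ} a n → (∀ k → k ℕ.< n → f (a + + k) ℕ.≤ g (a + + k)) → ∑ f a n ℕ.≤ ∑ g a n
  ∑-mono a zero    _   = z≤n
  ∑-mono a (suc n) f≤g = ℕP.+-mono-≤ (∑-mono a n (λ k k<n → f≤g k (ℕP.m<n⇒m<1+n k<n))) (f≤g n ℕP.≤-refl)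

  ∑-+ : ∀ (g : ℤ → ℕ) a n → ∑ (λ i → f i ℕ.+ g i) a n ≡ ∑ f a n ℕ.+ ∑ g a n
  ∑-+ g a zero    = refl
  ∑-+ g a (suc n) rewrite ∑-+ g a n = interchange (∑ f a n) (∑ g a n) (f (a + + n)) (g (a + + n))
    where
    interchange : ∀ x y z w → x ℕ.+ y ℕ.+ (z ℕ.+ w) ≡ x ℕ.+ z ℕ.+ (y ℕ.+ w)
    interchange = ℕ-solve-∀

  ∑-restrict : ∀ a p len q → (∀ k → k ℕ.< p → f (a + + k) ≡ 0) →
    (∀ k → k ℕ.< q → f (a + + p + + len + + k) ≡ 0) → ∑ f a (p ℕ.+ len ℕ.+ q) ≡ ∑ f (a + + p) len
  ∑-restrict a p len q below above = begin
    ∑ f a (p ℕ.+ len ℕ.+ q)                                   ≡⟨ ∑-++ a (p ℕ.+ len) q ⟩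
    ∑ f a (p ℕ.+ len) ℕ.+ ∑ f (a + + (p ℕ.+ len)) q          ≡⟨ cong₂ ℕ._+_ (∑-++ a p len) vanishAbove ⟩
    ∑ f a p ℕ.+ ∑ f (a + + p) len ℕ.+ 0                       ≡⟨ cong (λ z → z ℕ.+ ∑ f (a + + p) len ℕ.+ 0) (∑-≡0 a p below) ⟩
    ∑ f (a + + p) len ℕ.+ 0                                   ≡⟨ ℕP.+-identityʳ _ ⟩
    ∑ f (a + + p) len                                         ∎
    where
    open ≡-Reasoning
    vanishAbove : ∑ f (a + + (p ℕ.+ len)) q ≡ 0
    vanishAbove rewrite sym (ℤP.+-assoc a (+ p) (+ len)) = ∑-≡0 _ q above

∑-𝟙≟ : ∀ x a n → InRange a n x → ∑ (λ i → 𝟙 (i ≟ℤ x)) a n ≡ 1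
∑-𝟙≟ x a zero    (k , () , _)
∑-𝟙≟ x a (suc n) (k , k<1+n , refl) with ℕP.m≤n⇒m<n∨m≡n (ℕP.≤-pred k<1+n)
... | inj₁ k<n  = cong₂ ℕ._+_ (∑-𝟙≟ (a + + k) a n (k , k<n , refl)) (𝟙-no (_ ≟ℤ _) (λ eq → ℕP.<-irrefl (sym (offset-injective a eq)) k<n))
... | inj₂ refl = cong₂ ℕ._+_
  (∑-≡0 _ a n (λ j j<n → 𝟙-no (_ ≟ℤ _) (λ eq → ℕP.<-irrefl (offset-injective a eq) j<n))) (𝟙-yes (_ ≟ℤ _) refl)

InWindow : ℤ → ℕ → ℤ → Set
InWindow lo len i = lo ≤ i × i < lo + + len

inWindow? : ∀ lo len i → Dec (InWindow lo len i)
inWindow? lo len i = (lo ℤP.≤? i) ×-dec (i ℤP.<? lo + + len)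

inWindow⇒inRange : ∀ {lo len i} → InWindow lo len i → InRange lo len i
inWindow⇒inRange {lo} {len} (lo≤i , i<lo+len) with ≤⇒∃ lo≤i
... | k , refl = k , subst (ℕ._≤ len) (ℕP.+-comm k 1)
  (offset-cancel-≤ lo (subst (_≤ lo + + len) (ℤP.+-assoc lo (+ k) (+ 1)) (<⇒+1≤ i<lo+len))) , refl

∑-window : ∀ {P : ℤ → Set} (P? : ∀ i → Dec (P i)) a p len q →
  ∑ (λ i → 𝟙 (inWindow? (a + + p) len i ×-dec P? i)) a (p ℕ.+ len ℕ.+ q) ≡ ∑ (λ i → 𝟙 (P? i)) (a + + p) len
∑-window P? a p len q = trans (∑-restrict _ a p len q below above) (∑-cong _ (a + + p) (a + + p) len inside)
  where
  below : ∀ k → k ℕ.< p → 𝟙 (inWindow? (a + + p) len (a + + k) ×-dec P? (a + + k)) ≡ 0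
  below k k<p = 𝟙-no _ λ ((a+p≤a+k , _) , _) → ℕP.<⇒≱ k<p (offset-cancel-≤ a a+p≤a+k)
  above : ∀ k → k ℕ.< q → 𝟙 (inWindow? (a + + p) len (a + + p + + len + + k) ×-dec P? (a + + p + + len + + k)) ≡ 0
  above k _ = 𝟙-no _ λ ((_ , i<a+p+len) , _) → ℤP.<⇒≱ i<a+p+len (ℤP.i≤i+j (a + + p + + len) (+ k))
  inside : ∀ k → k ℕ.< len → 𝟙 (inWindow? (a + + p) len (a + + p + + k) ×-dec P? (a + + p + + k)) ≡ 𝟙 (P? (a + + p + + k))
  inside k k<len = 𝟙-×-dec (inWindow? (a + + p) len (a + + p + + k)) (P? (a + + p + + k))
    (ℤP.i≤i+j (a + + p) (+ k) , ℤP.+-monoʳ-< (a + + p) (ℤ.+<+ k<len))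

𝟙∈ : List ℤ → ℤ → ℕ
𝟙∈ X i = 𝟙 (i ∈? X)

𝟙∉ : List ℤ → ℤ → ℕ
𝟙∉ X i = 𝟙 (¬? (i ∈? X))

𝟙∈-∷ : ∀ {x xs} i → x ∉ xs → 𝟙∈ (x ∷ xs) i ≡ 𝟙 (i ≟ℤ x) ℕ.+ 𝟙∈ xs i
𝟙∈-∷ {x} {xs} i x∉xs = split (i ≟ℤ x) (i ∈? xs)
  where
  split : (i≟x : Dec (i ≡ x)) (i∈?xs : Dec (i ∈ xs)) → 𝟙∈ (x ∷ xs) i ≡ 𝟙 i≟x ℕ.+ 𝟙 i∈?xs
  split (yes refl) (yes i∈xs) = ⊥-elim (x∉xs i∈xs)
  split (yes refl) (no  _)    = 𝟙-yes (i ∈? (i ∷ xs)) (here refl)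
  split (no  _)    (yes i∈xs) = 𝟙-yes (i ∈? (x ∷ xs)) (there i∈xs)
  split (no  i≢x)  (no  i∉xs) = 𝟙-no (i ∈? (x ∷ xs)) λ { (here i≡x) → i≢x i≡x ; (there i∈xs) → i∉xs i∈xs }

length≡∑𝟙∈ : ∀ {X} a n → Unique X → (∀ {z} → z ∈ X → InRange a n z) → length X ≡ ∑ (𝟙∈ X) a n
length≡∑𝟙∈ {[]}     a n _ _ = sym (∑-≡0 _ a n (λ k _ → 𝟙-no ((a + + k) ∈? []) λ ()))
length≡∑𝟙∈ {x ∷ xs} a n (x∉xs ∷ uxs) X⊆ = begin
  suc (length xs)                                   ≡⟨ cong suc (length≡∑𝟙∈ a n uxs (λ z∈ → X⊆ (there z∈))) ⟩
  1 ℕ.+ ∑ (𝟙∈ xs) a n                              ≡⟨ cong (ℕ._+ ∑ (𝟙∈ xs) a n) (∑-𝟙≟ x a n (X⊆ (here refl))) ⟨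
  ∑ (λ i → 𝟙 (i ≟ℤ x)) a n ℕ.+ ∑ (𝟙∈ xs) a n      ≡⟨ ∑-+ _ (𝟙∈ xs) a n ⟨
  ∑ (λ i → 𝟙 (i ≟ℤ x) ℕ.+ 𝟙∈ xs i) a n            ≡⟨ ∑-cong _ a a n (λ k _ → sym (𝟙∈-∷ (a + + k) (All¬⇒¬Any x∉xs))) ⟩
  ∑ (𝟙∈ (x ∷ xs)) a n                               ∎
  where open ≡-Reasoning

∑𝟙∈+∑𝟙∉ : ∀ X a n → ∑ (𝟙∈ X) a n ℕ.+ ∑ (𝟙∉ X) a n ≡ n
∑𝟙∈+∑𝟙∉ X a n = trans (sym (∑-+ (𝟙∈ X) (𝟙∉ X) a n)) (∑-≡len _ a n (λ k _ → 𝟙+𝟙¬≡1 ((a + + k) ∈? X)))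

private
  length-filter-∷ : ∀ {P : ℤ → Set} (P? : ∀ i → Dec (P i)) x xs →
    length (filter P? (x ∷ xs)) ≡ 𝟙 (P? x) ℕ.+ length (filter P? xs)
  length-filter-∷ P? x xs with P? x
  ... | yes _ = refl
  ... | no  _ = refl

  length-filter-applyUpTo : ∀ {P : ℤ → Set} (P? : ∀ i → Dec (P i)) g a m → (∀ k → g k ≡ a + + k) →
    length (filter P? (applyUpTo g m)) ≡ ∑ (λ i → 𝟙 (P? i)) a m
  length-filter-applyUpTo P? g a zero    _    = refl
  length-filter-applyUpTo P? g a (suc m) g≡a+ = begin
    length (filter P? (applyUpTo g (suc m)))                          ≡⟨ length-filter-∷ P? (g 0) _ ⟩
    𝟙 (P? (g 0)) ℕ.+ length (filter P? (applyUpTo (λ k → g (suc k)) m)) ≡⟨ cong₂ ℕ._+_ (cong (λ z → 𝟙 (P? z)) g0≡a) IH ⟩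
    𝟙 (P? a) ℕ.+ ∑ (λ i → 𝟙 (P? i)) (a + + 1) m                        ≡⟨ ∑-head _ a m ⟨
    ∑ (λ i → 𝟙 (P? i)) a (suc m)                                      ∎
    where
    open ≡-Reasoning
    g0≡a : g 0 ≡ a
    g0≡a = trans (g≡a+ 0) (ℤP.+-identityʳ a)
    IH : length (filter P? (applyUpTo (λ k → g (suc k)) m)) ≡ ∑ (λ i → 𝟙 (P? i)) (a + + 1) m
    IH = length-filter-applyUpTo P? (λ k → g (suc k)) (a + + 1) m
           (λ k → trans (g≡a+ (suc k)) (sym (ℤP.+-assoc a (+ 1) (+ k))))

  range≡map : ∀ a b L → b - a + + 1 ≡ + L → range a b ≡ map (λ k → a + + k) (upTo L)
  range≡map a b L eq with b - a
  ... | + n          rewrite sym (ℤP.+-injective eq) | ℕP.+-comm n 1 = refl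
  ... | -[1+ 0 ]     rewrite sym (ℤP.+-injective eq) = refl
  ... | -[1+ suc _ ] with () ← eq

hIn≡∑𝟙∉ : ∀ X a b L → b - a + + 1 ≡ + L → hIn X a b ≡ + ∑ (𝟙∉ X) a L
hIn≡∑𝟙∉ X a b L eq rewrite range≡map a b L eq | ListP.map-upTo (λ k → a + + k) L =
  cong +_ (length-filter-applyUpTo _ _ a L (λ _ → refl))

card-range : ∀ a b L → b - a + + 1 ≡ + L → card (range a b) ≡ + L
card-range a b L eq rewrite range≡map a b L eq =
  cong +_ (trans (ListP.length-map _ (upTo L)) (ListP.length-upTo L))

sumset⁺ : ∀ {A B a b z} → a ∈ A → b ∈ B → a + b ≡ z → z ∈ sumset A B
sumset⁺ a∈A b∈B refl = ∈-deduplicate⁺ _≟ℤ_ (∈-cartesianProductWith⁺ _+_ a∈A b∈B)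

sumset⁻ : ∀ {A B z} → z ∈ sumset A B → ∃₂ λ a b → a ∈ A × b ∈ B × z ≡ a + b
sumset⁻ {A} {B} z∈S = ∈-cartesianProductWith⁻ _+_ A B (∈-deduplicate⁻ _≟ℤ_ (cartesianProductWith _+_ A B) z∈S)

sumset-unique : ∀ A B → Unique (sumset A B)
sumset-unique A B = deduplicate-! (cartesianProductWith _+_ A B)

-- The sumset A + B

-- Here N = n and M = m = n + D.
module Sumset (A B : List ℤ) (n D : ℕ) (uA : Unique A) (uB : Unique B)
  (minA : IsMin A (+ 0)) (maxA : IsMax A (+ (n ℕ.+ D)))
  (minB : IsMin B (+ 0)) (maxB : IsMax B (+ n)) where

  m : ℕ
  m = n ℕ.+ D

  S : List ℤ
  S = sumset A B

  n≤m : n ℕ.≤ m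
  n≤m = ℕP.m≤m+n n D

  B⊆S : ∀ {b} → b ∈ B → b ∈ S
  B⊆S b∈B = sumset⁺ (proj₁ minA) b∈B (ℤP.+-identityˡ _)

  B+m⊆S : ∀ {b} → b ∈ B → b + + m ∈ S
  B+m⊆S {b} b∈B = sumset⁺ (proj₁ maxA) b∈B (ℤP.+-comm (+ m) b)

  S-bounds : ∀ {z} → z ∈ S → + 0 ≤ z × z ≤ + m + + n
  S-bounds z∈S with sumset⁻ z∈S
  ... | a , b , a∈A , b∈B , refl =
    ℤP.+-mono-≤ (All.lookup (proj₂ minA) a∈A) (All.lookup (proj₂ minB) b∈B) ,
    ℤP.+-mono-≤ (All.lookup (proj₂ maxA) a∈A) (All.lookup (proj₂ maxB) b∈B)

  length-A : length A ≡ ∑ (𝟙∈ A) (+ 0) (suc m)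
  length-A = length≡∑𝟙∈ (+ 0) (suc m) uA
    (λ a∈A → inRange m (All.lookup (proj₂ minA) a∈A) (All.lookup (proj₂ maxA) a∈A))

  length-B : ∀ a L → a ≤ + 0 → + n ≤ a + + L → length B ≡ ∑ (𝟙∈ B) a (suc L)
  length-B a L a≤0 n≤a+L = length≡∑𝟙∈ a (suc L) uB
    (λ b∈B → inRange L (ℤP.≤-trans a≤0 (All.lookup (proj₂ minB) b∈B)) (ℤP.≤-trans (All.lookup (proj₂ maxB) b∈B) n≤a+L))

  length-B-split : length B ≡ 1 ℕ.+ ∑ (𝟙∈ B) (+ 1) n
  length-B-split = trans (length-B (+ 0) n ℤP.≤-refl ℤP.≤-refl)
    (trans (∑-head (𝟙∈ B) (+ 0) n) (cong (ℕ._+ ∑ (𝟙∈ B) (+ 1) n) (𝟙-yes (+ 0 ∈? B) (proj₁ minB))))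

  length-S-split : length S ≡ 1 ℕ.+ (∑ (𝟙∈ S) (+ 1) n ℕ.+ (∑ (𝟙∈ S) (+ suc n) D ℕ.+ ∑ (𝟙∈ S) (+ suc m) n))
  length-S-split = begin
    length S                                 ≡⟨ length≡∑𝟙∈ (+ 0) (suc (n ℕ.+ (D ℕ.+ n))) (sumset-unique A B) S⊆ ⟩
    ∑ (𝟙∈ S) (+ 0) (suc (n ℕ.+ (D ℕ.+ n)))   ≡⟨ ∑-head (𝟙∈ S) (+ 0) (n ℕ.+ (D ℕ.+ n)) ⟩
    𝟙∈ S (+ 0) ℕ.+ ∑ (𝟙∈ S) (+ 1) (n ℕ.+ (D ℕ.+ n))
      ≡⟨ cong₂ ℕ._+_ (𝟙-yes _ (sumset⁺ (proj₁ minA) (proj₁ minB) refl))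
                     (trans (∑-++ (𝟙∈ S) (+ 1) n (D ℕ.+ n)) (cong (∑ (𝟙∈ S) (+ 1) n ℕ.+_) (∑-++ (𝟙∈ S) (+ suc n) D n))) ⟩
    1 ℕ.+ (∑ (𝟙∈ S) (+ 1) n ℕ.+ (∑ (𝟙∈ S) (+ suc n) D ℕ.+ ∑ (𝟙∈ S) (+ suc m) n)) ∎
    where
    open ≡-Reasoning
    S⊆ : ∀ {z} → z ∈ S → InRange (+ 0) (suc (n ℕ.+ (D ℕ.+ n))) z
    S⊆ {z} z∈S = inRange (n ℕ.+ (D ℕ.+ n)) (proj₁ (S-bounds z∈S))
      (subst (z ≤_) (cong +_ (ℕP.+-assoc n D n)) (proj₂ (S-bounds z∈S)))

  holesA : ℕ
  holesA = ∑ (𝟙∉ A) (+ 0) (suc m)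

  holes⇒fewHoles : hIn A (+ 0) (+ m) ≤ + length B - + 2 → holesA ℕ.+ 2 ℕ.≤ length B
  holes⇒fewHoles holes = ℤP.drop‿+≤+ (≤-via₁ holes (trans (ring (+ length B) (+ holesA))
    (cong (λ h → + length B - + 2 - h) (sym (hIn≡∑𝟙∉ A (+ 0) (+ m) (suc m) (ring′ (+ m)))))))
    where
    ring : ∀ b h → b - (h + + 2) ≡ b - + 2 - h
    ring = solve-∀
    ring′ : ∀ m → m - + 0 + + 1 ≡ + 1 + m
    ring′ = solve-∀

  length-A+holesA : length A ℕ.+ holesA ≡ suc m
  length-A+holesA = trans (cong (ℕ._+ holesA) length-A) (∑𝟙∈+∑𝟙∉ A (+ 0) (suc m))

  ∉S-reflect : ∀ {x} k → x ∉ S → x - k ∈ B → k ∉ A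
  ∉S-reflect {x} k x∉S x-k∈B k∈A = x∉S (sumset⁺ k∈A x-k∈B (k+[x-k]≡x k x))
    where
    k+[x-k]≡x : ∀ k x → k + (x - k) ≡ x
    k+[x-k]≡x = solve-∀

  ∉S⇒𝟙∈B≤𝟙∉A : ∀ {x} k → x ∉ S → 𝟙∈ B (x - k) ℕ.≤ 𝟙∉ A k
  ∉S⇒𝟙∈B≤𝟙∉A {x} k x∉S = 𝟙-mono ((x - k) ∈? B) (¬? (k ∈? A)) (∉S-reflect k x∉S)

  ∑-B-reflected : ∀ x → ∑ (λ k → 𝟙∈ B (x - k)) (+ 0) (suc m) ≡ ∑ (𝟙∈ B) (x - + m) (suc m)
  ∑-B-reflected x = ∑-reflect (𝟙∈ B) x (+ 0) (x - + m) (suc m) (regroup x (+ m))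
    where
    regroup : ∀ x t → x - t + (+ 1 + t) ≡ x - + 0 + + 1
    regroup = solve-∀

  ∉S⇒∑B≤holesA : ∀ {x} → x ∉ S → ∑ (𝟙∈ B) (x - + m) (suc m) ℕ.≤ holesA
  ∉S⇒∑B≤holesA {x} x∉S = subst (ℕ._≤ holesA) (∑-B-reflected x)
    (∑-mono _ (+ 0) (suc m) (λ k _ → ∉S⇒𝟙∈B≤𝟙∉A (+ 0 + + k) x∉S))

  module FewHoles (fewHoles : holesA ℕ.+ 2 ℕ.≤ length B) where

    private
      |B|≤holesA+1⇒⊥ : length B ℕ.≤ holesA ℕ.+ 1 → ⊥
      |B|≤holesA+1⇒⊥ = ℕP.<⇒≱ (subst (ℕ._≤ length B) (ℕP.+-suc holesA 1) fewHoles)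

    [n,m]⊆S : ∀ {x} → + n ≤ x → x ≤ + m → x ∈ S
    [n,m]⊆S {x} n≤x x≤m = decidable-stable (x ∈? S) λ x∉S → |B|≤holesA+1⇒⊥ (begin
      length B                     ≡⟨ length-B (x - + m) m (ℤP.i≤j⇒i-j≤0 x≤m) (subst (+ n ≤_) (sym ([i-j]+j≡i x (+ m))) n≤x) ⟩
      ∑ (𝟙∈ B) (x - + m) (suc m)  ≤⟨ ∉S⇒∑B≤holesA x∉S ⟩
      holesA                       ≤⟨ ℕP.m≤m+n holesA 1 ⟩
      holesA ℕ.+ 1                 ∎)
      where open ℕP.≤-Reasoning

    -- B ⊆ [z − M, z + M]. Reflecting through z and through z + M, no k ∈ A is hit, and only k = z
    -- is hit twice, so |B| ≤ h_A + 1.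
    ¬both-holes : ∀ {z} → + 0 ≤ z → z ≤ + n → z ∉ S → z + + m ∉ S → ⊥
    ¬both-holes {z} 0≤z z≤N z∉S z+m∉S = |B|≤holesA+1⇒⊥ (begin
      length B                                                    ≡⟨ length-B (z - + m) (m ℕ.+ m) z-m≤0 n≤z+m ⟩
      ∑ (𝟙∈ B) (z - + m) (suc m ℕ.+ m)                            ≡⟨ ∑-++′ (𝟙∈ B) (z - + m) (z + + 1) (suc m) m (sym (ring₁ z (+ m))) ⟩
      ∑ (𝟙∈ B) (z - + m) (suc m) ℕ.+ ∑ (𝟙∈ B) (z + + 1) m
        ≤⟨ ℕP.+-monoʳ-≤ (∑ (𝟙∈ B) (z - + m) (suc m)) (ℕP.m≤n+m _ (𝟙∈ B z)) ⟩
      ∑ (𝟙∈ B) (z - + m) (suc m) ℕ.+ (𝟙∈ B z ℕ.+ ∑ (𝟙∈ B) (z + + 1) m)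
        ≡⟨ cong₂ ℕ._+_ (∑-B-reflected z)
             (trans (∑-reflect (𝟙∈ B) (z + + m) (+ 0) z (suc m) (ring₂ z (+ m))) (∑-head (𝟙∈ B) z m)) ⟨
      ∑ (λ k → 𝟙∈ B (z - k)) (+ 0) (suc m) ℕ.+ ∑ (λ k → 𝟙∈ B (z + + m - k)) (+ 0) (suc m)
                                                                   ≡⟨ ∑-+ _ _ (+ 0) (suc m) ⟨
      ∑ (λ k → 𝟙∈ B (z - k) ℕ.+ 𝟙∈ B (z + + m - k)) (+ 0) (suc m) ≤⟨ ∑-mono _ (+ 0) (suc m) (λ k _ → pointwise (+ 0 + + k)) ⟩
      ∑ (λ k → 𝟙∉ A k ℕ.+ 𝟙 (k ≟ℤ z)) (+ 0) (suc m)               ≡⟨ ∑-+ _ _ (+ 0) (suc m) ⟩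
      holesA ℕ.+ ∑ (λ k → 𝟙 (k ≟ℤ z)) (+ 0) (suc m)
        ≡⟨ cong (holesA ℕ.+_) (∑-𝟙≟ z (+ 0) (suc m) (inRange m 0≤z (ℤP.≤-trans z≤N (+≤+ n≤m)))) ⟩
      holesA ℕ.+ 1                                                ∎)
      where
      open ℕP.≤-Reasoning
      ring₁ : ∀ z m → z - m + (+ 1 + m) ≡ z + + 1
      ring₁ = solve-∀
      ring₂ : ∀ z m → z + (+ 1 + m) ≡ z + m - + 0 + + 1
      ring₂ = solve-∀
      z-m≤0 : z - + m ≤ + 0
      z-m≤0 = ℤP.i≤j⇒i-j≤0 (ℤP.≤-trans z≤N (+≤+ n≤m))
      n≤z+m : + n ≤ z - + m + + (m ℕ.+ m)
      n≤z+m = ≤-via 0≤z (+≤+ n≤m) (ring₃ z (+ m) (+ n))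
        where
        ring₃ : ∀ z m n → z - m + (m + m) - n ≡ z - + 0 + (m - n)
        ring₃ = solve-∀
      pointwise : ∀ k → 𝟙∈ B (z - k) ℕ.+ 𝟙∈ B (z + + m - k) ℕ.≤ 𝟙∉ A k ℕ.+ 𝟙 (k ≟ℤ z)
      pointwise k = 𝟙+𝟙≤𝟙+𝟙 ((z - k) ∈? B) ((z + + m - k) ∈? B) (¬? (k ∈? A)) (k ≟ℤ z)
        (∉S-reflect k z∉S) (∉S-reflect k z+m∉S)
        (λ z-k∈B z+m-k∈B → ℤP.≤-antisym
          (ℤP.0≤i-j⇒j≤i (All.lookup (proj₂ minB) z-k∈B))
          (≤-via (All.lookup (proj₂ maxB) z+m-k∈B) (+≤+ n≤m) (ring₄ z (+ m) k (+ n))))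
        where
        ring₄ : ∀ z m k n → k - z ≡ n - (z + m - k) + (m - n)
        ring₄ = solve-∀

    DoublyCovered : ℤ → Set
    DoublyCovered i = i ∉ B × i ∈ S × i + + m ∈ S

    doublyCovered? : ∀ i → Dec (DoublyCovered i)
    doublyCovered? i = ¬? (i ∈? B) ×-dec ((i ∈? S) ×-dec ((i + + m) ∈? S))

    pair-covered : ∀ {i} → + 0 ≤ i → i ≤ + n → 1 ℕ.+ 𝟙∈ B i ℕ.+ 𝟙 (doublyCovered? i) ℕ.≤ 𝟙∈ S i ℕ.+ 𝟙∈ S (i + + m)
    pair-covered {i} 0≤i i≤n = go (i ∈? B) (i ∈? S) ((i + + m) ∈? S)
      where
      go : (b? : Dec (i ∈ B)) (s? : Dec (i ∈ S)) (s+m? : Dec (i + + m ∈ S)) →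
        1 ℕ.+ 𝟙 b? ℕ.+ 𝟙 (¬? b? ×-dec (s? ×-dec s+m?)) ℕ.≤ 𝟙 s? ℕ.+ 𝟙 s+m?
      go (yes _)   (yes _)   (yes _)     = ℕP.≤-refl
      go (yes i∈B) (no i∉S)  _           = ⊥-elim (i∉S (B⊆S i∈B))
      go (yes i∈B) (yes _)   (no i+m∉S)  = ⊥-elim (i+m∉S (B+m⊆S i∈B))
      go (no _)    (yes _)   (yes _)     = ℕP.≤-refl
      go (no _)    (yes _)   (no _)      = ℕP.≤-refl
      go (no _)    (no _)    (yes _)     = ℕP.≤-refl
      go (no _)    (no i∉S)  (no i+m∉S)  = ⊥-elim (¬both-holes 0≤i i≤n i∉S i+m∉S)

    pairs-covered : n ℕ.+ ∑ (𝟙∈ B) (+ 1) n ℕ.+ ∑ (λ i → 𝟙 (doublyCovered? i)) (+ 1) n ℕ.≤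
                    ∑ (𝟙∈ S) (+ 1) n ℕ.+ ∑ (𝟙∈ S) (+ suc m) n
    pairs-covered = begin
      n ℕ.+ ∑ (𝟙∈ B) (+ 1) n ℕ.+ ∑ (λ i → 𝟙 (doublyCovered? i)) (+ 1) n
        ≡⟨ cong (λ t → t ℕ.+ ∑ (𝟙∈ B) (+ 1) n ℕ.+ ∑ (λ i → 𝟙 (doublyCovered? i)) (+ 1) n) (∑-≡len (λ _ → 1) (+ 1) n (λ _ _ → refl)) ⟨
      ∑ (λ _ → 1) (+ 1) n ℕ.+ ∑ (𝟙∈ B) (+ 1) n ℕ.+ ∑ (λ i → 𝟙 (doublyCovered? i)) (+ 1) n
        ≡⟨ trans (∑-+ (λ i → 1 ℕ.+ 𝟙∈ B i) (λ i → 𝟙 (doublyCovered? i)) (+ 1) n)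
                 (cong (ℕ._+ ∑ (λ i → 𝟙 (doublyCovered? i)) (+ 1) n) (∑-+ (λ _ → 1) (𝟙∈ B) (+ 1) n)) ⟨
      ∑ (λ i → 1 ℕ.+ 𝟙∈ B i ℕ.+ 𝟙 (doublyCovered? i)) (+ 1) n
        ≤⟨ ∑-mono _ (+ 1) n (λ k k<n → pair-covered (+≤+ z≤n) (+≤+ k<n)) ⟩
      ∑ (λ i → 𝟙∈ S i ℕ.+ 𝟙∈ S (i + + m)) (+ 1) n
        ≡⟨ ∑-+ _ _ (+ 1) n ⟩
      ∑ (𝟙∈ S) (+ 1) n ℕ.+ ∑ (λ i → 𝟙∈ S (i + + m)) (+ 1) n
        ≡⟨ cong (∑ (𝟙∈ S) (+ 1) n ℕ.+_) (∑-cong _ (+ 1) (+ suc m) n (λ k _ → cong (λ t → 𝟙∈ S (+ t)) (shift k m))) ⟩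
      ∑ (𝟙∈ S) (+ 1) n ℕ.+ ∑ (𝟙∈ S) (+ suc m) n ∎
      where
      open ℕP.≤-Reasoning
      shift : ∀ k m → suc (k ℕ.+ m) ≡ suc (m ℕ.+ k)
      shift = ℕ-solve-∀

    -- S contains 0 and [N + 1, M]; the other points of [0, M + N] pair up as i, i + M with i ∈ [1, N].
    m+|B|+doublyCovered≤|S| : m ℕ.+ length B ℕ.+ ∑ (λ i → 𝟙 (doublyCovered? i)) (+ 1) n ℕ.≤ length S
    m+|B|+doublyCovered≤|S| = begin
      m ℕ.+ length B ℕ.+ G                                ≡⟨ cong (λ b → m ℕ.+ b ℕ.+ G) length-B-split ⟩
      n ℕ.+ D ℕ.+ (1 ℕ.+ ∑ (𝟙∈ B) (+ 1) n) ℕ.+ G         ≡⟨ regroup n D (∑ (𝟙∈ B) (+ 1) n) G ⟩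
      1 ℕ.+ (D ℕ.+ (n ℕ.+ ∑ (𝟙∈ B) (+ 1) n ℕ.+ G))       ≤⟨ ℕP.+-monoʳ-≤ 1 (ℕP.+-monoʳ-≤ D pairs-covered) ⟩
      1 ℕ.+ (D ℕ.+ (X ℕ.+ Y))                             ≡⟨ cong (λ d → 1 ℕ.+ (d ℕ.+ (X ℕ.+ Y))) middle ⟨
      1 ℕ.+ (∑ (𝟙∈ S) (+ suc n) D ℕ.+ (X ℕ.+ Y))          ≡⟨ cong suc (regroup′ (∑ (𝟙∈ S) (+ suc n) D) X Y) ⟩
      1 ℕ.+ (X ℕ.+ (∑ (𝟙∈ S) (+ suc n) D ℕ.+ Y))          ≡⟨ length-S-split ⟨
      length S                                            ∎
      where
      open ℕP.≤-Reasoning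
      G X Y : ℕ
      G = ∑ (λ i → 𝟙 (doublyCovered? i)) (+ 1) n
      X = ∑ (𝟙∈ S) (+ 1) n
      Y = ∑ (𝟙∈ S) (+ suc m) n
      regroup : ∀ n D b G → n ℕ.+ D ℕ.+ (1 ℕ.+ b) ℕ.+ G ≡ 1 ℕ.+ (D ℕ.+ (n ℕ.+ b ℕ.+ G))
      regroup = ℕ-solve-∀
      regroup′ : ∀ d x y → d ℕ.+ (x ℕ.+ y) ≡ x ℕ.+ (d ℕ.+ y)
      regroup′ = ℕ-solve-∀
      middle : ∑ (𝟙∈ S) (+ suc n) D ≡ D
      middle = ∑-≡len _ (+ suc n) D (λ k k<D →
        𝟙-yes _ ([n,m]⊆S (+≤+ (ℕP.m≤n⇒m≤1+n (ℕP.m≤m+n n k))) (+≤+ (ℕP.+-monoʳ-< n k<D))))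

  e+1≥0 : ∀ {e} → IsGreatestLeftStableHole A B (+ n) e → + 0 ≤ e + + 1
  e+1≥0 {e} (inj₁ ((0≤e , _) , _)) = ℤP.≤-trans 0≤e (ℤP.i≤i+j e (+ 1))
  e+1≥0     (inj₂ (_ , refl))      = ℤP.≤-refl

  e∉S : ∀ {e} → IsGreatestLeftStableHole A B (+ n) e → e ∉ S
  e∉S (inj₁ ((_ , _ , _ , e∉S) , _)) = e∉S
  e∉S (inj₂ (_ , refl))               = λ -1∈S → ℤP.<⇒≱ ℤ.-<+ (proj₁ (S-bounds -1∈S))

  c≥1 : ∀ {c} → IsSmallestRightStableHole A B (+ m) (+ n) c → + 1 ≤ c
  c≥1 (inj₁ ((1≤c , _) , _)) = 1≤c
  c≥1 (inj₂ (_ , refl))      = +≤+ (ℕP.m≤n+m 1 n)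

  c≤n+1 : ∀ {c} → IsSmallestRightStableHole A B (+ m) (+ n) c → c ≤ + n + + 1
  c≤n+1 (inj₁ ((_ , c≤n , _) , _)) = ℤP.≤-trans c≤n (ℤP.i≤i+j (+ n) (+ 1))
  c≤n+1 (inj₂ (_ , refl))          = ℤP.≤-refl

  c+m∉S : ∀ {c} → IsSmallestRightStableHole A B (+ m) (+ n) c → c + + m ∉ S
  c+m∉S (inj₁ ((_ , _ , _ , c+m∉S) , _)) = c+m∉S
  c+m∉S (inj₂ (_ , refl))                 = λ n+1+m∈S →
    i+1≰i {+ m + + n} (subst (_≤ + m + + n) (n+1+m≡ (+ n) (+ m)) (proj₂ (S-bounds n+1+m∈S)))
    where
    n+1+m≡ : ∀ n m → n + + 1 + m ≡ m + n + + 1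
    n+1+m≡ = solve-∀

  no-left-hole-above : ∀ {e} → IsGreatestLeftStableHole A B (+ n) e → ∀ x → e < x → ¬ LeftStableHole A B (+ n) x
  no-left-hole-above (inj₁ (_ , greatest)) x e<x lsh = ℤP.<⇒≱ e<x (greatest x lsh)
  no-left-hole-above (inj₂ (none , _))     x _   lsh = none x lsh

  no-right-hole-below : ∀ {c} → IsSmallestRightStableHole A B (+ m) (+ n) c → ∀ y → y < c → ¬ RightStableHole A B (+ m) (+ n) y
  no-right-hole-below (inj₁ (_ , smallest)) y y<c rsh = ℤP.<⇒≱ y<c (smallest y rsh)
  no-right-hole-below (inj₂ (none , _))     y _   rsh = none y rsh

  J⊆S : ∀ {e c} → IsGreatestLeftStableHole A B (+ n) e → IsSmallestRightStableHole A B (+ m) (+ n) c →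
    holesA ℕ.+ 2 ℕ.≤ length B → ∀ x → e + + 1 ≤ x → x ≤ + m + c - + 1 → x ∈ S
  J⊆S {e} {c} he hc fewHoles x e+1≤x x≤m+c-1 = decidable-stable (x ∈? S) λ x∉S → split x∉S (x ℤP.≤? + n - + 1) (x ℤP.≤? + m)
    where
    open FewHoles fewHoles
    split : x ∉ S → Dec (x ≤ + n - + 1) → Dec (x ≤ + m) → ⊥
    split x∉S (yes x≤n-1) _ = no-left-hole-above he x (+1≤⇒< e+1≤x)
      (ℤP.≤-trans (e+1≥0 he) e+1≤x , x≤n-1 , (λ x∈B → x∉S (B⊆S x∈B)) , x∉S)
    split x∉S (no x≰n-1) (yes x≤m) = x∉S ([n,m]⊆S n≤x x≤m)
      where
      n≤x : + n ≤ x
      n≤x = subst (_≤ x) ([i-j]+j≡i (+ n) (+ 1)) (<⇒+1≤ (ℤP.≰⇒> x≰n-1))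
    split x∉S (no _) (no x≰m) = no-right-hole-below hc y y<c
      (1≤y , y≤n , (λ y∈B → x∉S (subst (_∈ S) y+m≡x (B+m⊆S y∈B))) , (λ y+m∈S → x∉S (subst (_∈ S) y+m≡x y+m∈S)))
      where
      y : ℤ
      y = x - + m
      y+m≡x : y + + m ≡ x
      y+m≡x = [i-j]+j≡i x (+ m)
      1≤y : + 1 ≤ y
      1≤y = ≤-via₁ (<⇒+1≤ (ℤP.≰⇒> x≰m)) (ring x (+ m))
        where
        ring : ∀ x m → x - m - + 1 ≡ x - (m + + 1)
        ring = solve-∀
      y+1≤c : y + + 1 ≤ c
      y+1≤c = ≤-via₁ x≤m+c-1 (ring x (+ m) c)
        where
        ring : ∀ x m c → c - (x - m + + 1) ≡ m + c - + 1 - x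
        ring = solve-∀
      y<c : y < c
      y<c = +1≤⇒< y+1≤c
      y≤n : y ≤ + n
      y≤n = ≤-via (c≤n+1 hc) y+1≤c (ring y c (+ n))
        where
        ring : ∀ y c n → n - y ≡ n + + 1 - c + (c - (y + + 1))
        ring = solve-∀

  private
    disjoint-reflection-≤ : ∀ x a b L → x ∉ S → b + + L ≡ x - a + + 1 →
      ∑ (𝟙∈ A) a L ℕ.+ ∑ (𝟙∈ B) b L ℕ.≤ L
    disjoint-reflection-≤ x a b L x∉S b+L≡ = begin
      ∑ (𝟙∈ A) a L ℕ.+ ∑ (𝟙∈ B) b L                   ≡⟨ cong (∑ (𝟙∈ A) a L ℕ.+_) (∑-reflect (𝟙∈ B) x a b L b+L≡) ⟨
      ∑ (𝟙∈ A) a L ℕ.+ ∑ (λ i → 𝟙∈ B (x - i)) a L     ≡⟨ ∑-+ _ _ a L ⟨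
      ∑ (λ i → 𝟙∈ A i ℕ.+ 𝟙∈ B (x - i)) a L
        ≤⟨ ∑-≤len _ a L (λ k _ → 𝟙+𝟙≤1 (_ ∈? A) (_ ∈? B) (λ i∈A x-i∈B → ∉S-reflect _ x∉S x-i∈B i∈A)) ⟩
      L                                                ∎
      where open ℕP.≤-Reasoning

  -- Here e = j − 1 and c = j + p. On [0, e] the reflection k ↦ e − k matches A against B disjointly
  -- because e ∉ S, and likewise on the right through c + M.
  count-between-holes : ∀ j p q → suc n ≡ j ℕ.+ p ℕ.+ q → + j - + 1 ∉ S → + (j ℕ.+ p) + + m ∉ S →
    length A ℕ.+ length B ℕ.+ ∑ (𝟙∉ A) (+ j) (p ℕ.+ D) ℕ.+ ∑ (𝟙∉ B) (+ j) p ℕ.≤ suc m ℕ.+ p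
  count-between-holes j p q n+1≡ e∉S c+m∉S = begin
    length A ℕ.+ length B ℕ.+ hA′ ℕ.+ hB′                                      ≡⟨ cong₂ (λ a b → a ℕ.+ b ℕ.+ hA′ ℕ.+ hB′) |A|≡ |B|≡ ⟩
    LA ℕ.+ MA ℕ.+ RA ℕ.+ (LB ℕ.+ MB ℕ.+ RB) ℕ.+ hA′ ℕ.+ hB′                     ≡⟨ regroup LA MA RA LB MB RB hA′ hB′ ⟩
    (LA ℕ.+ LB) ℕ.+ (RA ℕ.+ RB) ℕ.+ (MA ℕ.+ hA′) ℕ.+ (MB ℕ.+ hB′)
      ≤⟨ ℕP.+-mono-≤ (ℕP.+-mono-≤ (ℕP.+-mono-≤ left right) (ℕP.≤-reflexive (∑𝟙∈+∑𝟙∉ A (+ j) (p ℕ.+ D))))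
                     (ℕP.≤-reflexive (∑𝟙∈+∑𝟙∉ B (+ j) p)) ⟩
    j ℕ.+ q ℕ.+ (p ℕ.+ D) ℕ.+ p                                                ≡⟨ total j p q D ⟩
    j ℕ.+ (p ℕ.+ D) ℕ.+ q ℕ.+ p                                                ≡⟨ cong (ℕ._+ p) m+1≡ ⟨
    suc m ℕ.+ p                                                                ∎
    where
    open ℕP.≤-Reasoning
    c LA MA RA LB MB RB hA′ hB′ : ℕ
    c = j ℕ.+ p
    LA = ∑ (𝟙∈ A) (+ 0) j
    MA = ∑ (𝟙∈ A) (+ j) (p ℕ.+ D)
    RA = ∑ (𝟙∈ A) (+ (j ℕ.+ (p ℕ.+ D))) q
    LB = ∑ (𝟙∈ B) (+ 0) j
    MB = ∑ (𝟙∈ B) (+ j) p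
    RB = ∑ (𝟙∈ B) (+ c) q
    hA′ = ∑ (𝟙∉ A) (+ j) (p ℕ.+ D)
    hB′ = ∑ (𝟙∉ B) (+ j) p
    regroup : ∀ la ma ra lb mb rb ha hb →
      la ℕ.+ ma ℕ.+ ra ℕ.+ (lb ℕ.+ mb ℕ.+ rb) ℕ.+ ha ℕ.+ hb ≡ (la ℕ.+ lb) ℕ.+ (ra ℕ.+ rb) ℕ.+ (ma ℕ.+ ha) ℕ.+ (mb ℕ.+ hb)
    regroup = ℕ-solve-∀
    total : ∀ j p q D → j ℕ.+ q ℕ.+ (p ℕ.+ D) ℕ.+ p ≡ j ℕ.+ (p ℕ.+ D) ℕ.+ q ℕ.+ p
    total = ℕ-solve-∀
    m+1≡ : suc m ≡ j ℕ.+ (p ℕ.+ D) ℕ.+ q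
    m+1≡ = trans (cong (ℕ._+ D) n+1≡) (shuffle j p q D)
      where
      shuffle : ∀ j p q D → j ℕ.+ p ℕ.+ q ℕ.+ D ≡ j ℕ.+ (p ℕ.+ D) ℕ.+ q
      shuffle = ℕ-solve-∀
    |A|≡ : length A ≡ LA ℕ.+ MA ℕ.+ RA
    |A|≡ = trans length-A (trans (cong (∑ (𝟙∈ A) (+ 0)) m+1≡) (∑-++₃ (𝟙∈ A) j (p ℕ.+ D) q))
    |B|≡ : length B ≡ LB ℕ.+ MB ℕ.+ RB
    |B|≡ = trans (length-B (+ 0) n ℤP.≤-refl ℤP.≤-refl) (trans (cong (∑ (𝟙∈ B) (+ 0)) n+1≡) (∑-++₃ (𝟙∈ B) j p q))
    left : LA ℕ.+ LB ℕ.≤ j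
    left = disjoint-reflection-≤ (+ j - + 1) (+ 0) (+ 0) j e∉S (ring (+ j))
      where
      ring : ∀ j → j ≡ j - + 1 - + 0 + + 1
      ring = solve-∀
    right : RA ℕ.+ RB ℕ.≤ q
    right = disjoint-reflection-≤ (+ c + + m) (+ (j ℕ.+ (p ℕ.+ D))) (+ c) q c+m∉S
      (trans (cong +_ (sym (trans (ℕP.+-comm n 1) n+1≡))) (ring (+ j) (+ p) (+ n) (+ D)))
      where
      ring : ∀ j p n d → n + + 1 ≡ j + p + (n + d) - (j + (p + d)) + + 1
      ring = solve-∀

  |J|≡ : ∀ {e c} → e < c → card (range (e + + 1) (+ m + c - + 1)) ≡ + m - + 1 + (c - e)
  |J|≡ {e} e<c with ≤⇒∃ (<⇒+1≤ e<c)
  ... | p , refl = trans (card-range (e + + 1) (+ m + (e + + 1 + + p) - + 1) (m ℕ.+ p) (length≡ e (+ m) (+ p))) (rearrange e (+ m) (+ p))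
    where
    length≡ : ∀ e m p → m + (e + + 1 + p) - + 1 - (e + + 1) + + 1 ≡ m + p
    length≡ = solve-∀
    rearrange : ∀ e m p → m + p ≡ m - + 1 + (e + + 1 + p - e)
    rearrange = solve-∀

  |A|+|B|-1+holes≤|J| : ∀ {e c} → IsGreatestLeftStableHole A B (+ n) e → IsSmallestRightStableHole A B (+ m) (+ n) c → e < c →
    + m - + 1 + (c - e) ≥ card A + card B - + 1 + hIn A (e + + 1) (c + + m - + n - + 1) + hIn B (e + + 1) (c - + 1)
  |A|+|B|-1+holes≤|J| {e} he hc e<c with ≤⇒∃ (e+1≥0 he) | ≤⇒∃ (<⇒+1≤ e<c) | ≤⇒∃ (c≤n+1 hc)
  ... | j , e+1≡j | p , refl | q , n+1≡c+q =
    ≤-via₁ (+≤+ count) (trans (cong₂ (λ hA hB → + m - + 1 + (e + + 1 + + p - e) - (card A + card B - + 1 + hA + hB)) holesA≡ holesB≡)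
                              (ring (+ length A) (+ length B) (+ hA′) (+ hB′) (+ m) e (+ p)))
    where
    hA′ hB′ : ℕ
    hA′ = ∑ (𝟙∉ A) (+ j) (p ℕ.+ D)
    hB′ = ∑ (𝟙∉ B) (+ j) p
    holesA≡ : hIn A (e + + 1) (e + + 1 + + p + + m - + n - + 1) ≡ + hA′
    holesA≡ = trans (hIn≡∑𝟙∉ A (e + + 1) (e + + 1 + + p + + m - + n - + 1) (p ℕ.+ D) (length≡ (e + + 1) (+ p) (+ n) (+ D)))
                    (cong (λ a → + ∑ (𝟙∉ A) a (p ℕ.+ D)) e+1≡j)
      where
      length≡ : ∀ f p n d → f + p + (n + d) - n - + 1 - f + + 1 ≡ p + d
      length≡ = solve-∀
    holesB≡ : hIn B (e + + 1) (e + + 1 + + p - + 1) ≡ + hB′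
    holesB≡ = trans (hIn≡∑𝟙∉ B (e + + 1) (e + + 1 + + p - + 1) p (length≡ (e + + 1) (+ p))) (cong (λ a → + ∑ (𝟙∉ B) a p) e+1≡j)
      where
      length≡ : ∀ f p → f + p - + 1 - f + + 1 ≡ p
      length≡ = solve-∀
    count : length A ℕ.+ length B ℕ.+ hA′ ℕ.+ hB′ ℕ.≤ suc m ℕ.+ p
    count = count-between-holes j p q
      (ℤP.+-injective (trans (cong +_ (ℕP.+-comm 1 n)) (trans n+1≡c+q (cong (λ f → f + + p + + q) e+1≡j))))
      (subst (_∉ S) (trans (sym ([i+j]-j≡i e (+ 1))) (cong (_- + 1) e+1≡j)) (e∉S he))
      (subst (λ c → c + + m ∉ S) (cong (_+ + p) e+1≡j) (c+m∉S hc))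
    ring : ∀ a b ha hb m e p → m - + 1 + (e + + 1 + p - e) - (a + b - + 1 + ha + hb) ≡ + 1 + m + p - (a + b + ha + hb)
    ring = solve-∀

  module Gap (y K v : ℕ) (x+v≡m : suc (y ℕ.+ K) ℕ.+ v ≡ m) where

    x : ℕ
    x = suc (y ℕ.+ K)

    Missing : ℤ → Set
    Missing k = k ∉ A × + y + + D ≤ k × k ≤ + x

    missing? : ∀ k → Dec (Missing k)
    missing? k = ¬? (k ∈? A) ×-dec ((+ y + + D ℤP.≤? k) ×-dec (k ℤP.≤? + x))

    ρ W Bin P Q : ℕ
    ρ = suc (y ℕ.+ v)
    W = ∑ (λ k → 𝟙 (missing? k)) (+ 0) (suc m)
    Bin = ∑ (𝟙∈ B) (+ suc y) K
    P = ∑ (𝟙∈ B) (- + v) ρ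
    Q = ∑ (𝟙∈ B) (+ x) ρ

    -v+ρ≡1+y : - + v + + ρ ≡ + suc y
    -v+ρ≡1+y = ring (+ y) (+ v)
      where
      ring : ∀ y v → - v + (+ 1 + (y + v)) ≡ + 1 + y
      ring = solve-∀

    length-B-around-gap : length B ≡ P ℕ.+ (Bin ℕ.+ Q)
    length-B-around-gap = begin
      length B                                  ≡⟨ length-B (- + v) (y ℕ.+ v ℕ.+ (K ℕ.+ ρ)) ℤP.neg-≤-pos n≤ ⟩
      ∑ (𝟙∈ B) (- + v) (ρ ℕ.+ (K ℕ.+ ρ))        ≡⟨ ∑-++′ (𝟙∈ B) (- + v) (+ suc y) ρ (K ℕ.+ ρ) (sym -v+ρ≡1+y) ⟩
      P ℕ.+ ∑ (𝟙∈ B) (+ suc y) (K ℕ.+ ρ)        ≡⟨ cong (P ℕ.+_) (∑-++ (𝟙∈ B) (+ suc y) K ρ) ⟩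
      P ℕ.+ (Bin ℕ.+ Q)                         ∎
      where
      open ≡-Reasoning
      n≤ : + n ≤ - + v + + (y ℕ.+ v ℕ.+ (K ℕ.+ ρ))
      n≤ = ≤-via (+≤+ n≤m) (+≤+ (z≤n {y})) (trans (ring (+ y) (+ v) (+ K) (+ n)) (cong (λ t → + t - + n + (+ y - + 0)) x+v≡m))
        where
        ring : ∀ y v K n → - v + (y + v + (K + (+ 1 + (y + v)))) - n ≡ + 1 + (y + K) + v - n + (y - + 0)
        ring = solve-∀

    B-reflected-through-x : ∑ (λ k → 𝟙∈ B (+ x - k)) (+ 0) (suc m) ≡ P ℕ.+ (Bin ℕ.+ ∑ (𝟙∈ B) (+ x) 1)
    B-reflected-through-x = begin
      ∑ (λ k → 𝟙∈ B (+ x - k)) (+ 0) (suc m)    ≡⟨ ∑-B-reflected (+ x) ⟩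
      ∑ (𝟙∈ B) (+ x - + m) (suc m)              ≡⟨ cong₂ (∑ (𝟙∈ B)) x-m≡-v m+1≡ ⟩
      ∑ (𝟙∈ B) (- + v) (ρ ℕ.+ (K ℕ.+ 1))        ≡⟨ ∑-++′ (𝟙∈ B) (- + v) (+ suc y) ρ (K ℕ.+ 1) (sym -v+ρ≡1+y) ⟩
      P ℕ.+ ∑ (𝟙∈ B) (+ suc y) (K ℕ.+ 1)        ≡⟨ cong (P ℕ.+_) (∑-++ (𝟙∈ B) (+ suc y) K 1) ⟩
      P ℕ.+ (Bin ℕ.+ ∑ (𝟙∈ B) (+ x) 1)          ∎
      where
      open ≡-Reasoning
      x-m≡-v : + x - + m ≡ - + v
      x-m≡-v = trans (cong (λ t → + x - + t) (sym x+v≡m)) (ring (+ x) (+ v))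
        where
        ring : ∀ x v → x - (x + v) ≡ - v
        ring = solve-∀
      m+1≡ : suc m ≡ ρ ℕ.+ (K ℕ.+ 1)
      m+1≡ = trans (cong suc (sym x+v≡m)) (ring y K v)
        where
        ring : ∀ y K v → suc (suc (y ℕ.+ K) ℕ.+ v) ≡ suc (y ℕ.+ v) ℕ.+ (K ℕ.+ 1)
        ring = ℕ-solve-∀

    B-reflected-through-y+m : ∑ (λ k → 𝟙∈ B (+ y + + m - k)) (+ 0) (suc m) ≡ 𝟙∈ B (+ y) ℕ.+ (Bin ℕ.+ Q)
    B-reflected-through-y+m = begin
      ∑ (λ k → 𝟙∈ B (+ y + + m - k)) (+ 0) (suc m) ≡⟨ ∑-reflect (𝟙∈ B) (+ y + + m) (+ 0) (+ y) (suc m) (ring (+ y) (+ m)) ⟩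
      ∑ (𝟙∈ B) (+ y) (suc m)                        ≡⟨ cong (λ t → ∑ (𝟙∈ B) (+ y) (suc t)) m≡ ⟩
      ∑ (𝟙∈ B) (+ y) (suc (K ℕ.+ ρ))                ≡⟨ ∑-head (𝟙∈ B) (+ y) (K ℕ.+ ρ) ⟩
      𝟙∈ B (+ y) ℕ.+ ∑ (𝟙∈ B) (+ y + + 1) (K ℕ.+ ρ) ≡⟨ cong (λ t → 𝟙∈ B (+ y) ℕ.+ ∑ (𝟙∈ B) (+ t) (K ℕ.+ ρ)) (ℕP.+-comm y 1) ⟩
      𝟙∈ B (+ y) ℕ.+ ∑ (𝟙∈ B) (+ suc y) (K ℕ.+ ρ)   ≡⟨ cong (𝟙∈ B (+ y) ℕ.+_) (∑-++ (𝟙∈ B) (+ suc y) K ρ) ⟩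
      𝟙∈ B (+ y) ℕ.+ (Bin ℕ.+ Q)                    ∎
      where
      open ≡-Reasoning
      ring : ∀ y m → y + (+ 1 + m) ≡ y + m - + 0 + + 1
      ring = solve-∀
      m≡ : m ≡ K ℕ.+ ρ
      m≡ = trans (sym x+v≡m) (ring′ y K v)
        where
        ring′ : ∀ y K v → suc (y ℕ.+ K) ℕ.+ v ≡ K ℕ.+ suc (y ℕ.+ v)
        ring′ = ℕ-solve-∀

    -- [x − M, x] ∪ [y, y + M] covers B and covers (y, x) twice; a k serving both reflections lies in
    -- [y + M − N, x] ∖ A.
    |B|+Bin≤holesA+W : + x ∉ S → + y + + m ∉ S → length B ℕ.+ Bin ℕ.≤ holesA ℕ.+ W
    |B|+Bin≤holesA+W x∉S y+m∉S = begin
      length B ℕ.+ Bin                                     ≡⟨ cong (ℕ._+ Bin) length-B-around-gap ⟩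
      P ℕ.+ (Bin ℕ.+ Q) ℕ.+ Bin                             ≡⟨ regroup P Bin Q ⟩
      P ℕ.+ Bin ℕ.+ (Bin ℕ.+ Q)
        ≤⟨ ℕP.+-mono-≤ (ℕP.+-monoʳ-≤ P (ℕP.m≤m+n Bin (∑ (𝟙∈ B) (+ x) 1))) (ℕP.m≤n+m (Bin ℕ.+ Q) (𝟙∈ B (+ y))) ⟩
      P ℕ.+ (Bin ℕ.+ ∑ (𝟙∈ B) (+ x) 1) ℕ.+ (𝟙∈ B (+ y) ℕ.+ (Bin ℕ.+ Q))
                                                           ≡⟨ cong₂ ℕ._+_ B-reflected-through-x B-reflected-through-y+m ⟨
      ∑ (λ k → 𝟙∈ B (+ x - k)) (+ 0) (suc m) ℕ.+ ∑ (λ k → 𝟙∈ B (+ y + + m - k)) (+ 0) (suc m)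
                                                           ≡⟨ ∑-+ _ _ (+ 0) (suc m) ⟨
      ∑ (λ k → 𝟙∈ B (+ x - k) ℕ.+ 𝟙∈ B (+ y + + m - k)) (+ 0) (suc m)
                                                           ≤⟨ ∑-mono _ (+ 0) (suc m) (λ k _ → pointwise (+ 0 + + k)) ⟩
      ∑ (λ k → 𝟙∉ A k ℕ.+ 𝟙 (missing? k)) (+ 0) (suc m)    ≡⟨ ∑-+ _ _ (+ 0) (suc m) ⟩
      holesA ℕ.+ W                                         ∎
      where
      open ℕP.≤-Reasoning
      regroup : ∀ p b q → p ℕ.+ (b ℕ.+ q) ℕ.+ b ≡ p ℕ.+ b ℕ.+ (b ℕ.+ q)
      regroup = ℕ-solve-∀
      pointwise : ∀ k → 𝟙∈ B (+ x - k) ℕ.+ 𝟙∈ B (+ y + + m - k) ℕ.≤ 𝟙∉ A k ℕ.+ 𝟙 (missing? k)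
      pointwise k = 𝟙+𝟙≤𝟙+𝟙 ((+ x - k) ∈? B) ((+ y + + m - k) ∈? B) (¬? (k ∈? A)) (missing? k)
        (∉S-reflect k x∉S) (∉S-reflect k y+m∉S)
        (λ x-k∈B y+m-k∈B → ∉S-reflect k x∉S x-k∈B ,
          ≤-via₁ (All.lookup (proj₂ maxB) y+m-k∈B) (ring (+ y) (+ n) (+ D) k) ,
          ℤP.0≤i-j⇒j≤i (All.lookup (proj₂ minB) x-k∈B))
        where
        ring : ∀ y n d k → k - (y + d) ≡ n - (y + (n + d) - k)
        ring = solve-∀

    W≤K+1 : 1 ℕ.≤ D → W ℕ.≤ suc K
    W≤K+1 1≤D = begin
      W
        ≤⟨ ∑-mono _ (+ 0) (suc m) (λ k _ → 𝟙-mono (missing? _) (inWindow? (+ suc y) (suc K) _ ×-dec yes tt) in-window) ⟩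
      ∑ (λ i → 𝟙 (inWindow? (+ suc y) (suc K) i ×-dec yes tt)) (+ 0) (suc m)
        ≡⟨ cong (∑ (λ i → 𝟙 (inWindow? (+ suc y) (suc K) i ×-dec yes tt)) (+ 0)) m+1≡ ⟩
      ∑ (λ i → 𝟙 (inWindow? (+ suc y) (suc K) i ×-dec yes tt)) (+ 0) (suc y ℕ.+ suc K ℕ.+ v)
        ≡⟨ ∑-window (λ _ → yes tt) (+ 0) (suc y) (suc K) v ⟩
      ∑ (λ _ → 1) (+ suc y) (suc K)
        ≡⟨ ∑-≡len _ (+ suc y) (suc K) (λ _ _ → refl) ⟩
      suc K ∎
      where
      open ℕP.≤-Reasoning
      m+1≡ : suc m ≡ suc y ℕ.+ suc K ℕ.+ v
      m+1≡ = trans (cong suc (sym x+v≡m)) (ring y K v)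
        where
        ring : ∀ y K v → suc (suc (y ℕ.+ K) ℕ.+ v) ≡ suc y ℕ.+ suc K ℕ.+ v
        ring = ℕ-solve-∀
      in-window : ∀ {i} → Missing i → InWindow (+ suc y) (suc K) i × ⊤
      in-window {i} (_ , y+D≤i , i≤x) =
        (ℤP.≤-trans (+≤+ (subst (ℕ._≤ y ℕ.+ D) (ℕP.+-comm y 1) (ℕP.+-monoʳ-≤ y 1≤D))) y+D≤i ,
         ℤP.≤-<-trans i≤x (ℤ.+<+ (s≤s (ℕP.≤-reflexive (sym (ℕP.+-suc y K)))))) , tt

    W+present≡K+2 : D ≡ 0 → W ℕ.+ ∑ (𝟙∈ A) (+ y) (suc (suc K)) ≡ suc (suc K)
    W+present≡K+2 D≡0 = begin
      W ℕ.+ ∑ (𝟙∈ A) (+ y) (suc (suc K))                             ≡⟨ cong (ℕ._+ ∑ (𝟙∈ A) (+ y) (suc (suc K))) W≡ ⟩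
      ∑ (𝟙∉ A) (+ y) (suc (suc K)) ℕ.+ ∑ (𝟙∈ A) (+ y) (suc (suc K)) ≡⟨ ℕP.+-comm (∑ (𝟙∉ A) (+ y) (suc (suc K))) _ ⟩
      ∑ (𝟙∈ A) (+ y) (suc (suc K)) ℕ.+ ∑ (𝟙∉ A) (+ y) (suc (suc K)) ≡⟨ ∑𝟙∈+∑𝟙∉ A (+ y) (suc (suc K)) ⟩
      suc (suc K)                                                   ∎
      where
      open ≡-Reasoning
      y+D≡y : + y + + D ≡ + y
      y+D≡y = trans (cong (λ d → + y + + d) D≡0) (ℤP.+-identityʳ (+ y))
      pointwise : ∀ i → 𝟙 (missing? i) ≡ 𝟙 (inWindow? (+ y) (suc (suc K)) i ×-dec ¬? (i ∈? A))
      pointwise i = 𝟙-cong (missing? i) (inWindow? (+ y) (suc (suc K)) i ×-dec ¬? (i ∈? A))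
        (λ (i∉A , y+D≤i , i≤x) → (subst (_≤ i) y+D≡y y+D≤i , ℤP.≤-<-trans i≤x (ℤ.+<+ x<)) , i∉A)
        (λ ((y≤i , i<) , i∉A) → i∉A , subst (_≤ i) (sym y+D≡y) y≤i , ≤-via₁ (<⇒+1≤ i<) (ring (+ y) (+ K) i))
        where
        x< : x ℕ.< y ℕ.+ suc (suc K)
        x< = ℕP.≤-reflexive (sym (trans (ℕP.+-suc y (suc K)) (cong suc (ℕP.+-suc y K))))
        ring : ∀ y K i → + 1 + (y + K) - i ≡ y + (+ 1 + (+ 1 + K)) - (i + + 1)
        ring = solve-∀
      W≡ : W ≡ ∑ (𝟙∉ A) (+ y) (suc (suc K))
      W≡ = begin
        W                                                                               ≡⟨ ∑-cong _ (+ 0) (+ 0) (suc m) (λ k _ → pointwise (+ 0 + + k)) ⟩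
        ∑ (λ i → 𝟙 (inWindow? (+ y) (suc (suc K)) i ×-dec ¬? (i ∈? A))) (+ 0) (suc m)
                                                                                        ≡⟨ cong (∑ _ (+ 0)) (trans (cong suc (sym x+v≡m)) (ring y K v)) ⟩
        ∑ (λ i → 𝟙 (inWindow? (+ y) (suc (suc K)) i ×-dec ¬? (i ∈? A))) (+ 0) (y ℕ.+ suc (suc K) ℕ.+ v)
                                                                                        ≡⟨ ∑-window (λ i → ¬? (i ∈? A)) (+ 0) y (suc (suc K)) v ⟩
        ∑ (𝟙∉ A) (+ y) (suc (suc K))                                                    ∎
        where
        ring : ∀ y K v → suc (suc (y ℕ.+ K) ℕ.+ v) ≡ y ℕ.+ suc (suc K) ℕ.+ v
        ring = ℕ-solve-∀

  module Tight (fewHoles : holesA ℕ.+ 2 ℕ.≤ length B) (δ : ℕ)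
               (small : length S ℕ.+ 3 ℕ.+ δ ℕ.≤ length A ℕ.+ length B ℕ.+ length B)
               (A⊆B⇒δ≡1 : (∀ {a} → a ∈ A → a ∈ B) → δ ≡ 1) where

    open FewHoles fewHoles

    private
      -- The sum of the five inequalities reads T + 1 ≤ T.
      counts-clash : ∀ {s a b G hA W Bin Bout K ex} →
        s ℕ.+ 3 ℕ.+ δ ℕ.≤ a ℕ.+ b ℕ.+ b → m ℕ.+ b ℕ.+ G ℕ.≤ s → b ℕ.+ Bin ℕ.≤ hA ℕ.+ W → a ℕ.+ hA ≡ suc m →
        Bout ℕ.+ ex ℕ.≤ G → Bin ℕ.+ Bout ≡ K → W ℕ.≤ suc K ℕ.+ (δ ℕ.+ ex) → ⊥
      counts-clash {s} {a} {b} {G} {hA} {W} {Bin} {Bout} {K} {ex} S-small S-large B-bound A+hA≡ G-large Bin+Bout≡ W-small =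
        ℕP.<-irrefl refl (subst₂ ℕ._≤_ lhs≡ rhs≡
          (ℕP.+-mono-≤ (ℕP.+-mono-≤ (ℕP.+-mono-≤ (ℕP.+-mono-≤ S-small S-large) B-bound) G-large) W-small))
        where
        T : ℕ
        T = s ℕ.+ m ℕ.+ b ℕ.+ b ℕ.+ G ℕ.+ W ℕ.+ δ ℕ.+ ex ℕ.+ K ℕ.+ 2
        lhs≡ : s ℕ.+ 3 ℕ.+ δ ℕ.+ (m ℕ.+ b ℕ.+ G) ℕ.+ (b ℕ.+ Bin) ℕ.+ (Bout ℕ.+ ex) ℕ.+ W ≡ suc T
        lhs≡ = trans (ring s m b G W δ ex Bin Bout) (cong (λ k → suc (s ℕ.+ m ℕ.+ b ℕ.+ b ℕ.+ G ℕ.+ W ℕ.+ δ ℕ.+ ex ℕ.+ k ℕ.+ 2)) Bin+Bout≡)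
          where
          ring : ∀ s m b G W δ ex Bin Bout → s ℕ.+ 3 ℕ.+ δ ℕ.+ (m ℕ.+ b ℕ.+ G) ℕ.+ (b ℕ.+ Bin) ℕ.+ (Bout ℕ.+ ex) ℕ.+ W
                                           ≡ suc (s ℕ.+ m ℕ.+ b ℕ.+ b ℕ.+ G ℕ.+ W ℕ.+ δ ℕ.+ ex ℕ.+ (Bin ℕ.+ Bout) ℕ.+ 2)
          ring = ℕ-solve-∀
        rhs≡ : a ℕ.+ b ℕ.+ b ℕ.+ s ℕ.+ (hA ℕ.+ W) ℕ.+ G ℕ.+ (suc K ℕ.+ (δ ℕ.+ ex)) ≡ T
        rhs≡ = trans (ring a hA s m b G W δ ex K)
          (trans (cong (ℕ._+ (s ℕ.+ b ℕ.+ b ℕ.+ G ℕ.+ W ℕ.+ δ ℕ.+ ex ℕ.+ K ℕ.+ 1)) A+hA≡) (ring′ s m b G W δ ex K))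
          where
          ring : ∀ a hA s m b G W δ ex K → a ℕ.+ b ℕ.+ b ℕ.+ s ℕ.+ (hA ℕ.+ W) ℕ.+ G ℕ.+ (suc K ℕ.+ (δ ℕ.+ ex))
                                     ≡ (a ℕ.+ hA) ℕ.+ (s ℕ.+ b ℕ.+ b ℕ.+ G ℕ.+ W ℕ.+ δ ℕ.+ ex ℕ.+ K ℕ.+ 1)
          ring = ℕ-solve-∀
          ring′ : ∀ s m b G W δ ex K → suc m ℕ.+ (s ℕ.+ b ℕ.+ b ℕ.+ G ℕ.+ W ℕ.+ δ ℕ.+ ex ℕ.+ K ℕ.+ 1)
                                  ≡ s ℕ.+ m ℕ.+ b ℕ.+ b ℕ.+ G ℕ.+ W ℕ.+ δ ℕ.+ ex ℕ.+ K ℕ.+ 2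
          ring′ = ℕ-solve-∀

    module AdjacentHoles (y K : ℕ) (x≤n : suc (y ℕ.+ K) ℕ.≤ n)
                         (x∉S : + suc (y ℕ.+ K) ∉ S) (y+m∉S : + y + + m ∉ S)
                         (between : ∀ w → InWindow (+ suc y) K w → w ∉ B → w ∈ S × w + + m ∈ S) where

      u : ℕ
      u = proj₁ (ℕP.m≤n⇒∃[o]m+o≡n x≤n)

      x+u≡n : suc (y ℕ.+ K) ℕ.+ u ≡ n
      x+u≡n = proj₂ (ℕP.m≤n⇒∃[o]m+o≡n x≤n)

      x+v≡m : suc (y ℕ.+ K) ℕ.+ (u ℕ.+ D) ≡ m
      x+v≡m = trans (sym (ℕP.+-assoc (suc (y ℕ.+ K)) u D)) (cong (ℕ._+ D) x+u≡n)

      open Gap y K (u ℕ.+ D) x+v≡m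

      G Bout : ℕ
      G = ∑ (λ i → 𝟙 (doublyCovered? i)) (+ 1) n
      Bout = ∑ (𝟙∉ B) (+ suc y) K

      gap? : ∀ i → Dec (InWindow (+ suc y) K i × i ∉ B)
      gap? i = inWindow? (+ suc y) K i ×-dec ¬? (i ∈? B)

      gap⇒doublyCovered : ∀ {i} → InWindow (+ suc y) K i × i ∉ B → DoublyCovered i
      gap⇒doublyCovered {i} (i∈W , i∉B) = i∉B , between i i∈W i∉B

      ∑gap≡Bout : ∑ (λ i → 𝟙 (gap? i)) (+ 1) n ≡ Bout
      ∑gap≡Bout = trans (cong (∑ (λ i → 𝟙 (gap? i)) (+ 1)) n≡) (∑-window (λ i → ¬? (i ∈? B)) (+ 1) y K (suc u))
        where
        n≡ : n ≡ y ℕ.+ K ℕ.+ suc u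
        n≡ = trans (sym x+u≡n) (sym (ℕP.+-suc (y ℕ.+ K) u))

      Bout+0≤G : Bout ℕ.+ 0 ℕ.≤ G
      Bout+0≤G = subst₂ ℕ._≤_ (trans ∑gap≡Bout (sym (ℕP.+-identityʳ Bout))) refl
        (∑-mono _ (+ 1) n (λ k _ → 𝟙-mono (gap? _) (doublyCovered? _) gap⇒doublyCovered))

      Bout+1≤G : D ≡ 0 → ∀ {a} → a ∈ A → a ∉ B → ¬ InWindow (+ y) (suc (suc K)) a → Bout ℕ.+ 1 ℕ.≤ G
      Bout+1≤G D≡0 {a} a∈A a∉B a∉[y,x] = begin
        Bout ℕ.+ 1                                                      ≡⟨ cong₂ ℕ._+_ ∑gap≡Bout (∑-𝟙≟ a (+ 1) n a∈[1,n]) ⟨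
        ∑ (λ i → 𝟙 (gap? i)) (+ 1) n ℕ.+ ∑ (λ i → 𝟙 (i ≟ℤ a)) (+ 1) n ≡⟨ ∑-+ _ _ (+ 1) n ⟨
        ∑ (λ i → 𝟙 (gap? i) ℕ.+ 𝟙 (i ≟ℤ a)) (+ 1) n                     ≤⟨ ∑-mono _ (+ 1) n (λ k _ → pointwise) ⟩
        G                                                               ∎
        where
        open ℕP.≤-Reasoning
        n≡m : + n ≡ + m
        n≡m = cong +_ (trans (sym (ℕP.+-identityʳ n)) (cong (n ℕ.+_) (sym D≡0)))
        a∈[1,n] : InRange (+ 1) n a
        a∈[1,n] = subst (λ l → InRange (+ 1) l a) x+u≡n (inRange (y ℕ.+ K ℕ.+ u) 1≤a a≤n)
          where
          1≤a : + 1 ≤ a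
          1≤a = <⇒+1≤ (ℤP.≤∧≢⇒< (All.lookup (proj₂ minA) a∈A) (λ 0≡a → a∉B (subst (_∈ B) 0≡a (proj₁ minB))))
          a≤n : a ≤ + suc (y ℕ.+ K ℕ.+ u)
          a≤n = subst (a ≤_) (trans (sym n≡m) (cong +_ (sym x+u≡n))) (All.lookup (proj₂ maxA) a∈A)
        a-doublyCovered : DoublyCovered a
        a-doublyCovered = a∉B , sumset⁺ a∈A (proj₁ minB) (ℤP.+-identityʳ a) , sumset⁺ a∈A (proj₁ maxB) (cong (_+_ a) n≡m)
        gap⊆[y,x] : ∀ {i} → InWindow (+ suc y) K i → InWindow (+ y) (suc (suc K)) i
        gap⊆[y,x] (1+y≤i , i<) = ℤP.≤-trans (+≤+ (ℕP.n≤1+n y)) 1+y≤i ,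
          ℤP.<-≤-trans i< (+≤+ (subst (suc y ℕ.+ K ℕ.≤_) (sym (ℕP.+-suc y (suc K))) (s≤s (ℕP.+-monoʳ-≤ y (ℕP.n≤1+n K)))))
        pointwise : ∀ {i} → 𝟙 (gap? i) ℕ.+ 𝟙 (i ≟ℤ a) ℕ.≤ 𝟙 (doublyCovered? i)
        pointwise {i} = 𝟙+𝟙≤𝟙 (gap? i) (i ≟ℤ a) (doublyCovered? i) gap⇒doublyCovered (λ { refl → a-doublyCovered })
          (λ { (i∈W , _) refl → a∉[y,x] (gap⊆[y,x] i∈W) })

      W≤K+1′ : D ≡ 0 → ∀ {a} → a ∈ A → InWindow (+ y) (suc (suc K)) a → W ℕ.≤ suc K
      W≤K+1′ D≡0 {a} a∈A a∈[y,x] = ℕP.+-cancelʳ-≤ 1 W (suc K) (begin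
        W ℕ.+ 1                                      ≡⟨ cong (W ℕ.+_) (∑-𝟙≟ a (+ y) (suc (suc K)) (inWindow⇒inRange a∈[y,x])) ⟨
        W ℕ.+ ∑ (λ i → 𝟙 (i ≟ℤ a)) (+ y) (suc (suc K))
          ≤⟨ ℕP.+-monoʳ-≤ W (∑-mono _ (+ y) (suc (suc K)) (λ k _ → 𝟙-mono (_ ≟ℤ a) (_ ∈? A) (λ { refl → a∈A }))) ⟩
        W ℕ.+ ∑ (𝟙∈ A) (+ y) (suc (suc K))           ≡⟨ W+present≡K+2 D≡0 ⟩
        suc (suc K)                                  ≡⟨ ℕP.+-comm 1 (suc K) ⟩
        suc K ℕ.+ 1                                  ∎)
        where open ℕP.≤-Reasoning

      W≤K+2 : D ≡ 0 → W ℕ.≤ suc (suc K)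
      W≤K+2 D≡0 = subst (W ℕ.≤_) (W+present≡K+2 D≡0) (ℕP.m≤m+n W _)

      -- The extra point ex = 1 arises when M = N and some a ∈ A ∖ B lies outside [y, x]: then a = a + 0
      -- and a + M = a + N lie in S.
      extra : Σ ℕ λ ex → Bout ℕ.+ ex ℕ.≤ G × W ℕ.≤ suc K ℕ.+ (δ ℕ.+ ex)
      extra = by-D D refl
        where
        K+1≤ : suc K ℕ.≤ suc K ℕ.+ (δ ℕ.+ 0)
        K+1≤ = ℕP.m≤m+n (suc K) (δ ℕ.+ 0)
        by-D : ∀ d → D ≡ d → Σ ℕ λ ex → Bout ℕ.+ ex ℕ.≤ G × W ℕ.≤ suc K ℕ.+ (δ ℕ.+ ex)
        by-D (suc _) D≡ = 0 , Bout+0≤G ,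
          ℕP.≤-trans (W≤K+1 (subst (1 ℕ.≤_) (sym D≡) (s≤s z≤n))) K+1≤
        by-D zero D≡0 with any? (λ a → inWindow? (+ y) (suc (suc K)) a) A | All.all? (_∈? B) A
        ... | yes some | _ with find some
        ...   | a , a∈A , a∈[y,x] = 0 , Bout+0≤G , ℕP.≤-trans (W≤K+1′ D≡0 a∈A a∈[y,x]) K+1≤
        by-D zero D≡0 | no none | yes A⊆B = 0 , Bout+0≤G , subst (W ℕ.≤_) K+2≡ (W≤K+2 D≡0)
          where
          K+2≡ : suc (suc K) ≡ suc K ℕ.+ (δ ℕ.+ 0)
          K+2≡ rewrite A⊆B⇒δ≡1 (All.lookup A⊆B) = ℕP.+-comm 1 (suc K)
        by-D zero D≡0 | no none | no A⊈B with find (¬All⇒Any¬ (_∈? B) A A⊈B)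
        ... | a , a∈A , a∉B = 1 , Bout+1≤G D≡0 a∈A a∉B (λ a∈[y,x] → none (lose a∈A a∈[y,x])) ,
          ℕP.≤-trans (W≤K+2 D≡0) (subst (ℕ._≤ suc K ℕ.+ (δ ℕ.+ 1)) (ℕP.+-comm (suc K) 1) (ℕP.+-monoʳ-≤ (suc K) (ℕP.m≤n+m 1 δ)))

      adjacent-holes⇒⊥ : ⊥
      adjacent-holes⇒⊥ = counts-clash small m+|B|+doublyCovered≤|S|
        (|B|+Bin≤holesA+W x∉S y+m∉S) length-A+holesA
        (proj₁ (proj₂ extra)) (∑𝟙∈+∑𝟙∉ B (+ suc y) K) (proj₂ (proj₂ extra))

    -- By strong induction on the gap: a stable hole strictly between gives a closer pair.
    no-right-hole-below-left-hole : ∀ gap y → RightStableHole A B (+ m) (+ n) (+ y) → LeftStableHole A B (+ n) (+ (y ℕ.+ gap)) → ⊥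
    no-right-hole-below-left-hole = <-rec Claim step
      where
      hole? : ∀ y k → Dec (+ suc (y ℕ.+ k) ∉ B × (+ suc (y ℕ.+ k) ∉ S ⊎ + suc (y ℕ.+ k) + + m ∉ S))
      hole? y k = ¬? (_ ∈? B) ×-dec (¬? (_ ∈? S) ⊎-dec ¬? (_ ∈? S))
      Claim : ℕ → Set
      Claim gap = ∀ y → RightStableHole A B (+ m) (+ n) (+ y) → LeftStableHole A B (+ n) (+ (y ℕ.+ gap)) → ⊥
      step : ∀ gap → (∀ {g} → g ℕ.< gap → Claim g) → Claim gap
      step zero _ y (_ , y≤n , _ , y+m∉S) (_ , _ , _ , y∉S) =
        ¬both-holes (+≤+ z≤n) y≤n (subst (_∉ S) (cong +_ (ℕP.+-identityʳ y)) y∉S) y+m∉S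
      step (suc K) rec y rsh@(_ , _ , _ , y+m∉S) lsh@(_ , x≤n-1 , _ , x∉S) with ℕP.anyUpTo? (hole? y) K
      ... | yes (k , k<K , w∉B , inj₁ w∉S) =
        rec (s≤s k<K) y rsh (+≤+ z≤n , ℤP.≤-trans (+≤+ w≤x) x≤n-1 , w∉B′ , w∉S′)
        where
        w≤x : y ℕ.+ suc k ℕ.≤ y ℕ.+ suc K
        w≤x = ℕP.+-monoʳ-≤ y (ℕP.<⇒≤ (s≤s k<K))
        w∉B′ : + (y ℕ.+ suc k) ∉ B
        w∉B′ = subst (_∉ B) (cong +_ (sym (ℕP.+-suc y k))) w∉B
        w∉S′ : + (y ℕ.+ suc k) ∉ S
        w∉S′ = subst (_∉ S) (cong +_ (sym (ℕP.+-suc y k))) w∉S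
      ... | no none = AdjacentHoles.adjacent-holes⇒⊥ y K x≤n (subst (_∉ S) (cong +_ (ℕP.+-suc y K)) x∉S) y+m∉S between
        where
        x≤n : suc (y ℕ.+ K) ℕ.≤ n
        x≤n = subst (ℕ._≤ n) (ℕP.+-suc y K) (ℤP.drop‿+≤+ (ℤP.≤-trans x≤n-1 (ℤP.i-j≤i (+ n) (+ 1))))
        between : ∀ v → InWindow (+ suc y) K v → v ∉ B → v ∈ S × v + + m ∈ S
        between v v∈W v∉B with inWindow⇒inRange v∈W
        ... | k , k<K , refl = decidable-stable (_ ∈? S) (λ v∉S → none (k , k<K , v∉B , inj₁ v∉S)) ,
                               decidable-stable (_ ∈? S) (λ v+m∉S → none (k , k<K , v∉B , inj₂ v+m∉S))
      ... | yes (k , k<K , w∉B , inj₂ w+m∉S) with ℕP.m≤n⇒∃[o]m+o≡n k<K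
      ...   | o , 1+k+o≡K = rec (s≤s (subst (suc o ℕ.≤_) 1+k+o≡K (s≤s (ℕP.m≤n+m o k)))) (suc (y ℕ.+ k))
                (+≤+ (s≤s z≤n) , ℤP.≤-trans (ℤP.≤-trans (+≤+ w≤x) x≤n-1) (ℤP.i-j≤i (+ n) (+ 1)) , w∉B , w+m∉S)
                (subst (λ t → LeftStableHole A B (+ n) (+ t)) x≡ lsh)
        where
        w≤x : suc (y ℕ.+ k) ℕ.≤ y ℕ.+ suc K
        w≤x = subst (suc (y ℕ.+ k) ℕ.≤_) (sym (ℕP.+-suc y K)) (s≤s (ℕP.+-monoʳ-≤ y (ℕP.<⇒≤ k<K)))
        x≡ : y ℕ.+ suc K ≡ suc (y ℕ.+ k) ℕ.+ suc o
        x≡ = trans (cong (λ t → y ℕ.+ suc t) (sym 1+k+o≡K)) (ring y k o)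
          where
          ring : ∀ y k o → y ℕ.+ suc (suc k ℕ.+ o) ≡ suc (y ℕ.+ k) ℕ.+ suc o
          ring = ℕ-solve-∀

    e<c : ∀ {e c} → IsGreatestLeftStableHole A B (+ n) e → IsSmallestRightStableHole A B (+ m) (+ n) c → e < c
    e<c {e} {c} he hc = ℤP.≰⇒> c≰e
      where
      c≰e : ¬ c ≤ e
      c≰e c≤e with ≤⇒∃ (ℤP.≤-trans (+≤+ z≤n) (c≥1 hc))
      ... | ĉ , refl with ≤⇒∃ c≤e
      ... | gap , refl = no-right-hole-below-left-hole gap ĉ (right-hole hc) left-hole
        where
        left-hole : LeftStableHole A B (+ n) (+ (ĉ ℕ.+ gap))
        left-hole = genuine he
          where
          genuine : IsGreatestLeftStableHole A B (+ n) (+ (ĉ ℕ.+ gap)) → LeftStableHole A B (+ n) (+ (ĉ ℕ.+ gap))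
          genuine (inj₁ (lsh , _)) = lsh
          genuine (inj₂ (_ , ()))
        right-hole : IsSmallestRightStableHole A B (+ m) (+ n) (+ ĉ) → RightStableHole A B (+ m) (+ n) (+ ĉ)
        right-hole (inj₁ (rsh , _))    = rsh
        right-hole (inj₂ (_ , ĉ≡n+1)) = ⊥-elim (i+1≰i (ℤP.≤-trans
          (subst (_≤ + n - + 1) ĉ≡n+1 (ℤP.≤-trans c≤e (proj₁ (proj₂ left-hole)))) (ℤP.i-j≤i (+ n) (+ 1))))

δ∈01 : ∀ {A B d} → IsDelta A B d → ∃ λ δ → d ≡ + δ × ((∀ {a} → a ∈ A → a ∈ B) → δ ≡ 1)
δ∈01 (inj₁ (_ , refl))       = 1 , refl , λ _ → refl
δ∈01 {B = B} (inj₂ (¬shift , refl)) = 0 , refl , λ A⊆B →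
  ⊥-elim (¬shift (+ 0 , λ a a∈A → subst (_∈ B) (sym (ℤP.+-identityˡ a)) (A⊆B a∈A)))

small-sumset : ∀ {s a b r δ} → + s ≡ + a + + b - + 1 + r → r ≤ + b - + 2 - + δ → s ℕ.+ 3 ℕ.+ δ ℕ.≤ a ℕ.+ b ℕ.+ b
small-sumset {s} {a} {b} {r} {δ} s≡ r≤ =
  ℤP.drop‿+≤+ (≤-via₁ r≤ (trans (cong (λ t → + a + + b + + b - (t + + 3 + + δ)) s≡) (rearrange (+ a) (+ b) r (+ δ))))
  where
  rearrange : ∀ a b r δ → a + b + b - (a + b - + 1 + r + + 3 + δ) ≡ b - + 2 - δ - r
  rearrange = solve-∀

proposition2p6 :
    (A B : List ℤ) → Unique A → Unique B → ¬ A ≡ [] → ¬ B ≡ [] →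
    (M N r d e c : ℤ) →
    IsMin A (+ 0) → IsMin B (+ 0) → IsMax A M → IsMax B N → M ≥ N →
    card (sumset A B) ≡ card A + card B - + 1 + r →
    IsDelta A B d →
    hIn A (+ 0) M ≤ card B - + 2 →
    r ≤ card B - + 2 - d →
    IsGreatestLeftStableHole A B N e →
    IsSmallestRightStableHole A B M N c →
    (∀ x → e + + 1 ≤ x → x ≤ M + c - + 1 → x ∈ sumset A B)
    × card (range (e + + 1) (M + c - + 1)) ≡ M - + 1 + (c - e)
    × M - + 1 + (c - e) ≥ card A + card B - + 1 + hIn A (e + + 1) (c + M - N - + 1) + hIn B (e + + 1) (c - + 1)
    × card A + card B - + 1 + hIn A (e + + 1) (c + M - N - + 1) + hIn B (e + + 1) (c - + 1) ≥ card A + card B - + 1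
proposition2p6 A B uA uB _ _ M N r d e c minA minB maxA maxB N≤M |S|≡ isδ holes r≤ he hc
  with ≤⇒∃ (All.lookup (proj₂ minB) (proj₁ maxB))
... | n , refl with ≤⇒∃ N≤M | δ∈01 isδ
... | D , refl | δ , refl , A⊆B⇒δ≡1 =
  J⊆S he hc fewHoles , |J|≡ e<c , |A|+|B|-1+holes≤|J| he hc e<c ,
  ℤP.≤-trans (ℤP.i≤i+j _ (hIn A (e + + 1) (c + + m - + n - + 1))) (ℤP.i≤i+j _ (hIn B (e + + 1) (c - + 1)))
  where
  open Sumset A B n D uA uB minA maxA minB maxB
  fewHoles : holesA ℕ.+ 2 ℕ.≤ length B
  fewHoles = holes⇒fewHoles holes
  e<c : e < c
  e<c = Tight.e<c fewHoles δ (small-sumset {a = length A} {b = length B} |S|≡ r≤) A⊆B⇒δ≡1 he hc
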